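{- Let $f=\bigwedge_{j=1}^m c_j$ be an instance of 1-Ex3MonoSat, and let RED1 map $f$ to the 3CNF formula $f'=\bigwedge_{j=1}^m c_j'$ where, for $c_j=(x+y+z)$, $c_j'=(x+y+z)\wedge(\overline{x}+\overline{y})\wedge(\overline{x}+\overline{z})\wedge(\overline{z}+\overline{y})$. Then: (1) the satisfying assignments of $f'$ are exactly the exactly-one satisfying assignments of $f$; (2) in any satisfying assignment of $f'$, all but one clause in each $c_j'$ has exactly one true literal; (3) each variable of $f'$ occurs at least twice negated and at least once unnegated; (4) RED1 is planarity preserving; (5) RED1 is parsimonious.
   Context: 1-Ex3MonoSat: given a CNF formula in which every clause consists of exactly three unnegated variables, is there an assignment (an "exactly-one satisfying assignment") making exactly one literal true in each clause. The bipartite graph of a CNF formula has one vertex per variable and one per clause, a clause joined to the variables occurring in it; a formula is planar iff this graph is planar. A reduction is planarity preserving if it maps planar instances to planar instances, and parsimonious if the number of solutions (exactly-one satisfying assignments of $f$, satisfying assignments of $f'$) is preserved. -}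

module Defs where

open import Data.Nat using (ℕ; zero; suc; _≡ᵇ_)
open import Data.Bool using (Bool; true; false; not; T; if_then_else_)
open import Data.Fin using (Fin)
open import Data.Vec using (Vec; []; _∷_; lookup)
open import Data.List using (List; []; _∷_; length; concatMap; filter; map; _++_)
import Data.List as L
open import Data.Bool.ListAction using (any; all)
open import Data.List.Relation.Unary.Any using (Any)
open import Data.Product using (Σ; _×_; _,_)
open import Data.Sum using (_⊎_; inj₁; inj₂)
open import Data.Empty using (⊥)
open import Relation.Binary.PropositionalEquality using (_≡_)
open import Relation.Nullary using (¬_)
open import Relation.Nullary.Decidable using (does)
open import Data.Rational using (ℚ; 0ℚ; 1ℚ) renaming (_+_ to _+ℚ_; _*_ to _*ℚ_; _-_ to _-ℚ_; _≤_ to _≤ℚ_)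

-- a monotone 3-clause (x + y + z) of a 1-Ex3MonoSat instance
MClause : ℕ → Set
MClause n = Fin n × Fin n × Fin n

Distinct3 : ∀ {n} → MClause n → Set
Distinct3 (x , y , z) = ¬ (x ≡ y) × ¬ (x ≡ z) × ¬ (y ≡ z)

MonoFormula : ℕ → Set
MonoFormula n = List (MClause n)

data Lit (n : ℕ) : Set where
  pos : Fin n → Lit n
  neg : Fin n → Lit n

var : ∀ {n} → Lit n → Fin n
var (pos x) = x
var (neg x) = x

Clause : ℕ → Set
Clause n = List (Lit n)

CNF : ℕ → Set
CNF n = List (Clause n)

Assignment : ℕ → Set
Assignment n = Vec Bool n

litVal : ∀ {n} → Assignment n → Lit n → Bool
litVal a (pos x) = lookup a x
litVal a (neg x) = not (lookup a x)

countTrue : List Bool → ℕ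
countTrue [] = zero
countTrue (true ∷ bs) = suc (countTrue bs)
countTrue (false ∷ bs) = countTrue bs

trueLits : ∀ {n} → Assignment n → Clause n → ℕ
trueLits a C = countTrue (map (litVal a) C)

clauseSatB : ∀ {n} → Assignment n → Clause n → Bool
clauseSatB a C = any (litVal a) C

satB : ∀ {n} → Assignment n → CNF n → Bool
satB a F = all (clauseSatB a) F

Sat : ∀ {n} → Assignment n → CNF n → Set
Sat a F = T (satB a F)

exOneClauseB : ∀ {n} → Assignment n → MClause n → Bool
exOneClauseB a (x , y , z) =
  countTrue (lookup a x ∷ lookup a y ∷ lookup a z ∷ []) ≡ᵇ 1

exSatB : ∀ {n} → Assignment n → MonoFormula n → Bool
exSatB a f = all (exOneClauseB a) f

ExSat : ∀ {n} → Assignment n → MonoFormula n → Set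
ExSat a f = T (exSatB a f)

allAssignments : (n : ℕ) → List (Assignment n)
allAssignments zero = [] ∷ []
allAssignments (suc n) =
  map (true ∷_) (allAssignments n) ++ map (false ∷_) (allAssignments n)

countWhere : ∀ {n} → (Assignment n → Bool) → ℕ
countWhere {n} p = countTrue (map p (allAssignments n))

numExSat : ∀ {n} → MonoFormula n → ℕ
numExSat f = countWhere (λ a → exSatB a f)

numSat : ∀ {n} → CNF n → ℕ
numSat F = countWhere (λ a → satB a F)

toClause : ∀ {n} → MClause n → Clause n
toClause (x , y , z) = pos x ∷ pos y ∷ pos z ∷ []

toCNF : ∀ {n} → MonoFormula n → CNF n
toCNF f = map toClause f

red1Clause : ∀ {n} → MClause n → CNF n
red1Clause (x , y , z) =
  (pos x ∷ pos y ∷ pos z ∷ []) ∷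
  (neg x ∷ neg y ∷ []) ∷
  (neg x ∷ neg z ∷ []) ∷
  (neg z ∷ neg y ∷ []) ∷ []

red1 : ∀ {n} → MonoFormula n → CNF n
red1 f = concatMap red1Clause f

OccursIn : ∀ {n} → Fin n → Clause n → Set
OccursIn v C = Any (λ l → var l ≡ v) C

VarOf : ∀ {n} → Fin n → CNF n → Set
VarOf v F = Any (OccursIn v) F

isPos : ∀ {n} → Fin n → Lit n → Bool
isPos v (pos x) = does (x Data.Fin.≟ v)
isPos v (neg x) = false

isNeg : ∀ {n} → Fin n → Lit n → Bool
isNeg v (pos x) = false
isNeg v (neg x) = does (x Data.Fin.≟ v)

posOcc : ∀ {n} → Fin n → CNF n → ℕ
posOcc v F = countTrue (map (isPos v) (L.concat F))

negOcc : ∀ {n} → Fin n → CNF n → ℕ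
negOcc v F = countTrue (map (isNeg v) (L.concat F))

exactlyOneClauses : ∀ {n} → Assignment n → CNF n → ℕ
exactlyOneClauses a F = countTrue (map (λ C → trueLits a C ≡ᵇ 1) F)

-- the bipartite (variable-clause) graph of a CNF formula:
-- vertices are the variables Fin n and the clauses (indexed by Fin (length F));
-- a clause is adjacent to the variables occurring in it
BipV : ∀ {n} → CNF n → Set
BipV {n} F = Fin n ⊎ Fin (length F)

BipE : ∀ {n} (F : CNF n) → BipV F → BipV F → Set
BipE F (inj₁ v) (inj₂ j) = OccursIn v (L.lookup F j)
BipE F (inj₂ j) (inj₁ v) = OccursIn v (L.lookup F j)
BipE F (inj₁ _) (inj₁ _) = ⊥
BipE F (inj₂ _) (inj₂ _) = ⊥

Point : Set
Point = ℚ × ℚ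

OnSeg : Point → Point → Point → Set
OnSeg (px , py) (qx , qy) t =
  Σ ℚ λ s → (0ℚ ≤ℚ s) × (s ≤ℚ 1ℚ) ×
    (t ≡ (px +ℚ (s *ℚ (qx -ℚ px)) , py +ℚ (s *ℚ (qy -ℚ py))))

-- a graph (V, E) is planar: it has a crossing-free straight-line drawing
-- (vertices at distinct points of ℚ², no vertex in the interior of an edge,
-- two distinct edges meet only in a common endpoint)
Planar : (V : Set) → (V → V → Set) → Set
Planar V E =
  Σ (V → Point) λ pos →
    (∀ u v → pos u ≡ pos v → u ≡ v) ×
    (∀ a b v → E a b → OnSeg (pos a) (pos b) (pos v) → (v ≡ a ⊎ v ≡ b)) ×
    (∀ a b c d t → E a b → E c d →
       OnSeg (pos a) (pos b) t → OnSeg (pos c) (pos d) t →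
       ((a ≡ c × b ≡ d) ⊎ (a ≡ d × b ≡ c)) ⊎
       Σ V λ v → (v ≡ a ⊎ v ≡ b) × (v ≡ c ⊎ v ≡ d) × (t ≡ pos v))

PlanarCNF : ∀ {n} → CNF n → Set
PlanarCNF F = Planar (BipV F) (BipE F)

{-# OPTIONS --safe #-}
module Submission where

-- Items (1), (2), (3) and (5) are checked one clause at a time. The binary clauses of c′ forbid two
-- true variables among x, y, z and (x + y + z) forbids none being true, so c′ holds exactly when c has
-- exactly one true variable, and then each binary clause has exactly one true literal; every variable
-- of c′ occurs in it twice negated per unnegated occurrence.
--
-- For planarity keep a straight-line drawing of f and put the three new clause vertices of c′ near
-- the vertex C of c, each inside the angular sector at C between the two arms it is joined to (pushed
-- away from the third arm when that sector is reflex). Pairs of old edges that are disjoint, or that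
-- share only a variable, are strictly separated by a line; finitely many strict separations survive a
-- small enough displacement, and inside one gadget the disjoint sectors keep the new edges apart.

module Clauses where

  open import Defs
  open import Data.Nat using (suc; _+_; _*_; _≤_; z≤n; s≤s)
  open import Data.Nat.Properties using (≤-trans; m≤m+n; m≤n+m; *-monoʳ-≤)
  open import Data.Bool using (Bool; true; false; _∧_; T)
  open import Data.Fin using (Fin; _≟_)
  open import Data.Vec using (lookup)
  open import Data.Product using (_×_; _,_)
  open import Data.Sum using (_⊎_; inj₁; inj₂)
  open import Data.List using ([]; _∷_; _++_; map; concat)
  open import Data.List.Properties using (map-++; map-cong; concat-++)
  open import Data.List.Relation.Unary.All as All using (All)
  open import Data.List.Relation.Unary.All.Properties using (all⁺)
  open import Data.List.Relation.Unary.Any using (here; there)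
  open import Data.List.Relation.Unary.Any.Properties using (++⁻)
  open import Function using (_∘_)
  open import Function.Bundles using (_⇔_; mk⇔; Equivalence)
  open import Relation.Binary.PropositionalEquality using (_≡_; refl; sym; trans; cong; subst)
  open import Relation.Nullary using (yes; no; contradiction)

  satB-red1Clause-++ : ∀ {n} (a : Assignment n) c (F : CNF n) →
    satB a (red1Clause c ++ F) ≡ exOneClauseB a c ∧ satB a F
  satB-red1Clause-++ a (x , y , z) F with lookup a x | lookup a y | lookup a z
  ... | true  | true  | true  = refl
  ... | true  | true  | false = refl
  ... | true  | false | true  = refl
  ... | true  | false | false = refl
  ... | false | true  | true  = refl
  ... | false | true  | false = refl
  ... | false | false | true  = refl
  ... | false | false | false = refl

  satB-red1 : ∀ {n} (a : Assignment n) f → satB a (red1 f) ≡ exSatB a f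
  satB-red1 a []      = refl
  satB-red1 a (c ∷ f) =
    trans (satB-red1Clause-++ a c (red1 f)) (cong (exOneClauseB a c ∧_) (satB-red1 a f))

  sat-red1⇔exSat : ∀ {n} (a : Assignment n) f → Sat a (red1 f) ⇔ ExSat a f
  sat-red1⇔exSat a f = mk⇔ (subst T (satB-red1 a f)) (subst T (sym (satB-red1 a f)))

  exactlyOneClauses-red1Clause : ∀ {n} (a : Assignment n) c →
    T (exOneClauseB a c) → exactlyOneClauses a (red1Clause c) ≡ 3
  exactlyOneClauses-red1Clause a (x , y , z) with lookup a x | lookup a y | lookup a z
  ... | true  | false | false = λ _ → refl
  ... | false | true  | false = λ _ → refl
  ... | false | false | true  = λ _ → refl
  ... | true  | true  | true  = λ ()
  ... | true  | true  | false = λ ()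
  ... | true  | false | true  = λ ()
  ... | false | true  | true  = λ ()
  ... | false | false | false = λ ()

  sat-red1⇒exactlyOneClauses : ∀ {n} (a : Assignment n) f → Sat a (red1 f) →
    All (λ c → exactlyOneClauses a (red1Clause c) ≡ 3) f
  sat-red1⇒exactlyOneClauses a f sat =
    All.map (exactlyOneClauses-red1Clause a _)
            (all⁺ (exOneClauseB a) f (Equivalence.to (sat-red1⇔exSat a f) sat))

  countTrue-++ : ∀ bs cs → countTrue (bs ++ cs) ≡ countTrue bs + countTrue cs
  countTrue-++ []           cs = refl
  countTrue-++ (true  ∷ bs) cs = cong suc (countTrue-++ bs cs)
  countTrue-++ (false ∷ bs) cs = countTrue-++ bs cs

  countTrue-map-concat-++ : ∀ {n} (p : Lit n → Bool) (F G : CNF n) →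
    countTrue (map p (concat (F ++ G))) ≡ countTrue (map p (concat F)) + countTrue (map p (concat G))
  countTrue-map-concat-++ p F G = trans
    (cong (countTrue ∘ map p) (sym (concat-++ F G)))
    (trans (cong countTrue (map-++ p (concat F) (concat G))) (countTrue-++ (map p (concat F)) _))

  varOf-red1Clause : ∀ {n} {v : Fin n} {x y z} → VarOf v (red1Clause (x , y , z)) → x ≡ v ⊎ y ≡ v ⊎ z ≡ v
  varOf-red1Clause (here (here e))                                 = inj₁ e
  varOf-red1Clause (here (there (here e)))                         = inj₂ (inj₁ e)
  varOf-red1Clause (here (there (there (here e))))                 = inj₂ (inj₂ e)
  varOf-red1Clause (there (here (here e)))                         = inj₁ e
  varOf-red1Clause (there (here (there (here e))))                 = inj₂ (inj₁ e)
  varOf-red1Clause (there (there (here (here e))))                 = inj₁ e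
  varOf-red1Clause (there (there (here (there (here e)))))         = inj₂ (inj₂ e)
  varOf-red1Clause (there (there (there (here (here e)))))         = inj₂ (inj₂ e)
  varOf-red1Clause (there (there (there (here (there (here e)))))) = inj₂ (inj₁ e)

  negOcc-red1Clause : ∀ {n} (v : Fin n) c → negOcc v (red1Clause c) ≡ 2 * posOcc v (red1Clause c)
  negOcc-red1Clause v (x , y , z) with x ≟ v | y ≟ v | z ≟ v
  ... | yes _ | yes _ | yes _ = refl
  ... | yes _ | yes _ | no  _ = refl
  ... | yes _ | no  _ | yes _ = refl
  ... | yes _ | no  _ | no  _ = refl
  ... | no  _ | yes _ | yes _ = refl
  ... | no  _ | yes _ | no  _ = refl
  ... | no  _ | no  _ | yes _ = refl
  ... | no  _ | no  _ | no  _ = refl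

  posOcc-red1Clause : ∀ {n} (v : Fin n) x y z → x ≡ v ⊎ y ≡ v ⊎ z ≡ v → 1 ≤ posOcc v (red1Clause (x , y , z))
  posOcc-red1Clause v x y z occ with x ≟ v | y ≟ v | z ≟ v
  ... | yes _ | _     | _     = s≤s z≤n
  ... | no  _ | yes _ | _     = s≤s z≤n
  ... | no  _ | no  _ | yes _ = s≤s z≤n
  ... | no x≢v | no y≢v | no z≢v with occ
  ...   | inj₁ x≡v        = contradiction x≡v x≢v
  ...   | inj₂ (inj₁ y≡v) = contradiction y≡v y≢v
  ...   | inj₂ (inj₂ z≡v) = contradiction z≡v z≢v

  occurrence-bounds : ∀ {n} (v : Fin n) f → VarOf v (red1 f) →
    2 ≤ negOcc v (red1 f) × 1 ≤ posOcc v (red1 f)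
  occurrence-bounds v ((x , y , z) ∷ f) occ
    rewrite countTrue-map-concat-++ (isNeg v) (red1Clause (x , y , z)) (red1 f)
          | countTrue-map-concat-++ (isPos v) (red1Clause (x , y , z)) (red1 f)
    with ++⁻ (red1Clause (x , y , z)) occ
  ... | inj₁ in-gadget = ≤-trans twice (m≤m+n _ _) , ≤-trans once (m≤m+n _ _)
    where
    once : 1 ≤ posOcc v (red1Clause (x , y , z))
    once = posOcc-red1Clause v x y z (varOf-red1Clause in-gadget)
    twice : 2 ≤ negOcc v (red1Clause (x , y , z))
    twice = subst (2 ≤_) (sym (negOcc-red1Clause v (x , y , z))) (*-monoʳ-≤ 2 once)
  ... | inj₂ in-rest = let neg₂ , pos₁ = occurrence-bounds v f in-rest
                       in ≤-trans neg₂ (m≤n+m _ _) , ≤-trans pos₁ (m≤n+m _ _)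

  numExSat≡numSat-red1 : ∀ {n} (f : MonoFormula n) → numExSat f ≡ numSat (red1 f)
  numExSat≡numSat-red1 {n} f = cong countTrue (map-cong (λ a → sym (satB-red1 a f)) (allAssignments n))

module RationalSigns where

  open import Data.Rational
    using (ℚ; 0ℚ; 1ℚ; _+_; _*_; _-_; -_; _<_; _≤_; _÷_; _⊓_; 1/_; NonZero;
           positive; negative; nonNegative; nonPositive; ≢-nonZero; >-nonZero)
  open import Data.Rational.Properties
  open import Data.Sum using (inj₁; inj₂)
  open import Data.Unit using (tt)
  open import Relation.Binary.Definitions using (tri<; tri≈; tri>)
  open import Relation.Binary.PropositionalEquality
  open import Relation.Nullary using (¬_; yes; no; contradiction)

  open import Algebra.Properties.Group +-0-group public
    using () renaming (⁻¹-involutive to neg-involutive;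
                       x∙y⁻¹≈ε⇒x≈y to p-q≡0⇒p≡q; x≈y⇒x∙y⁻¹≈ε to p≡q⇒p-q≡0)

  private variable p q r : ℚ

  0<1 : 0ℚ < 1ℚ
  0<1 = positive⁻¹ 1ℚ {{record { pos = tt }}}

  <⇒≱ : p < q → ¬ (q ≤ p)
  <⇒≱ p<q q≤p = <-irrefl refl (<-≤-trans p<q q≤p)

  *-pos : 0ℚ < p → 0ℚ < q → 0ℚ < p * q
  *-pos {p} {q} p>0 q>0 = positive⁻¹ (p * q) {{pos*pos⇒pos p {{positive p>0}} q {{positive q>0}}}}

  *-nonNeg : 0ℚ ≤ p → 0ℚ ≤ q → 0ℚ ≤ p * q
  *-nonNeg {p} {q} p≥0 q≥0 =
    nonNegative⁻¹ (p * q) {{nonNeg*nonNeg⇒nonNeg p {{nonNegative p≥0}} q {{nonNegative q≥0}}}}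

  *-pos-neg : 0ℚ < p → q < 0ℚ → p * q < 0ℚ
  *-pos-neg {p} {q} p>0 q<0 = negative⁻¹ (p * q) {{pos*neg⇒neg p {{positive p>0}} q {{negative q<0}}}}

  *-neg-pos : p < 0ℚ → 0ℚ < q → p * q < 0ℚ
  *-neg-pos {p} {q} p<0 q>0 = negative⁻¹ (p * q) {{neg*pos⇒neg p {{negative p<0}} q {{positive q>0}}}}

  *-neg-neg : p < 0ℚ → q < 0ℚ → 0ℚ < p * q
  *-neg-neg {p} {q} p<0 q<0 = positive⁻¹ (p * q) {{neg*neg⇒pos p {{negative p<0}} q {{negative q<0}}}}

  *-nonNeg-nonPos : 0ℚ ≤ p → q ≤ 0ℚ → p * q ≤ 0ℚ
  *-nonNeg-nonPos {p} {q} p≥0 q≤0 =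
    nonPositive⁻¹ (p * q) {{nonNeg*nonPos⇒nonPos p {{nonNegative p≥0}} q {{nonPositive q≤0}}}}

  +-pos : 0ℚ < p → 0ℚ ≤ q → 0ℚ < p + q
  +-pos {p} {q} p>0 q≥0 = positive⁻¹ (p + q) {{pos+nonNeg⇒pos p {{positive p>0}} q {{nonNegative q≥0}}}}

  +-nonNeg : 0ℚ ≤ p → 0ℚ ≤ q → 0ℚ ≤ p + q
  +-nonNeg {p} {q} p≥0 q≥0 =
    nonNegative⁻¹ (p + q) {{nonNeg+nonNeg⇒nonNeg p {{nonNegative p≥0}} q {{nonNegative q≥0}}}}

  +-neg : p < 0ℚ → q < 0ℚ → p + q < 0ℚ
  +-neg {p} {q} p<0 q<0 = negative⁻¹ (p + q) {{neg+neg⇒neg p {{negative p<0}} q {{negative q<0}}}}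

  +-neg-nonPos : p < 0ℚ → q ≤ 0ℚ → p + q < 0ℚ
  +-neg-nonPos {p} {q} p<0 q≤0 = negative⁻¹ (p + q) {{neg+nonPos⇒neg p {{negative p<0}} q {{nonPositive q≤0}}}}

  +-nonPos-neg : p ≤ 0ℚ → q < 0ℚ → p + q < 0ℚ
  +-nonPos-neg {p} {q} p≤0 q<0 = negative⁻¹ (p + q) {{nonPos+neg⇒neg p {{nonPositive p≤0}} q {{negative q<0}}}}

  neg-cancel-< : 0ℚ < - p → p < 0ℚ
  neg-cancel-< {p} -p>0 = subst (_< 0ℚ) (neg-involutive p) (neg-antimono-< -p>0)

  q-p+p≡q : ∀ p q → (q - p) + p ≡ q
  q-p+p≡q p q = trans (+-assoc q (- p) p) (trans (cong (q +_) (+-inverseˡ p)) (+-identityʳ q))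

  p<q⇒0<q-p : p < q → 0ℚ < q - p
  p<q⇒0<q-p {p} {q} p<q = subst (_< q - p) (+-inverseʳ p) (+-monoˡ-< (- p) p<q)

  0<q-p⇒p<q : 0ℚ < q - p → p < q
  0<q-p⇒p<q {q} {p} q-p>0 = subst₂ _<_ (+-identityˡ p) (q-p+p≡q p q) (+-monoˡ-< p q-p>0)

  p≤q⇒0≤q-p : p ≤ q → 0ℚ ≤ q - p
  p≤q⇒0≤q-p {p} {q} p≤q = subst (_≤ q - p) (+-inverseʳ p) (+-monoˡ-≤ (- p) p≤q)

  0≤q-p⇒p≤q : 0ℚ ≤ q - p → p ≤ q
  0≤q-p⇒p≤q {q} {p} q-p≥0 = subst₂ _≤_ (+-identityˡ p) (q-p+p≡q p q) (+-monoˡ-≤ p q-p≥0)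

  ⊓-pos : 0ℚ < p → 0ℚ < q → 0ℚ < p ⊓ q
  ⊓-pos {p} {q} p>0 q>0 with ⊓-sel p q
  ... | inj₁ p⊓q≡p = subst (0ℚ <_) (sym p⊓q≡p) p>0
  ... | inj₂ p⊓q≡q = subst (0ℚ <_) (sym p⊓q≡q) q>0

  data Sign (p : ℚ) : Set where
    <0 : p < 0ℚ → Sign p
    ≡0 : p ≡ 0ℚ → Sign p
    >0 : 0ℚ < p → Sign p

  sign : ∀ p → Sign p
  sign p with <-cmp p 0ℚ
  ... | tri< p<0 _ _ = <0 p<0
  ... | tri≈ _ p≡0 _ = ≡0 p≡0
  ... | tri> _ _ p>0 = >0 p>0

  ≤∧≢⇒< : p ≤ q → p ≢ q → p < q
  ≤∧≢⇒< {p} {q} p≤q p≢q with <-cmp p q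
  ... | tri< p<q _ _ = p<q
  ... | tri≈ _ p≡q _ = contradiction p≡q p≢q
  ... | tri> _ _ p>q = contradiction p≤q (<⇒≱ p>q)

  0≤p*p : ∀ p → 0ℚ ≤ p * p
  0≤p*p p with sign p
  ... | <0 p<0 = <⇒≤ (*-neg-neg p<0 p<0)
  ... | ≡0 refl = ≤-refl
  ... | >0 p>0 = <⇒≤ (*-pos p>0 p>0)

  p≢0⇒0<p*p : ∀ p → p ≢ 0ℚ → 0ℚ < p * p
  p≢0⇒0<p*p p p≢0 with sign p
  ... | <0 p<0 = *-neg-neg p<0 p<0
  ... | ≡0 p≡0 = contradiction p≡0 p≢0
  ... | >0 p>0 = *-pos p>0 p>0

  p*p≤0⇒p≡0 : ∀ p → p * p ≤ 0ℚ → p ≡ 0ℚ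
  p*p≤0⇒p≡0 p pp≤0 with p ≟ 0ℚ
  ... | yes p≡0 = p≡0
  ... | no  p≢0 = contradiction pp≤0 (<⇒≱ (p≢0⇒0<p*p p p≢0))

  *-cancelˡ-≡0 : p ≢ 0ℚ → p * q ≡ 0ℚ → q ≡ 0ℚ
  *-cancelˡ-≡0 {p} {q} p≢0 pq≡0 = begin
    q              ≡⟨ *-identityˡ q ⟨
    1ℚ * q         ≡⟨ cong (_* q) (*-inverseˡ p {{≢-nonZero p≢0}}) ⟨
    (1/p * p) * q  ≡⟨ *-assoc 1/p p q ⟩
    1/p * (p * q)  ≡⟨ cong (1/p *_) pq≡0 ⟩
    1/p * 0ℚ       ≡⟨ *-zeroʳ 1/p ⟩
    0ℚ             ∎
    where
    open ≡-Reasoning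
    1/p = (1/ p) {{≢-nonZero p≢0}}

  *-cancelʳ-pos : 0ℚ < r → 0ℚ < p * r → 0ℚ < p
  *-cancelʳ-pos {r} {p} r>0 pr>0 =
    *-cancelʳ-<-nonNeg r {{nonNegative (<⇒≤ r>0)}} (subst (_< p * r) (sym (*-zeroˡ r)) pr>0)

  *-cancelʳ-nonNeg : 0ℚ < r → 0ℚ ≤ p * r → 0ℚ ≤ p
  *-cancelʳ-nonNeg {r} {p} r>0 pr≥0 =
    *-cancelʳ-≤-pos r {{positive r>0}} (subst (_≤ p * r) (sym (*-zeroˡ r)) pr≥0)

  ÷-pos : ∀ {p q} → 0ℚ < p → (q>0 : 0ℚ < q) → 0ℚ < (p ÷ q) {{>-nonZero q>0}}
  ÷-pos {p} {q} p>0 q>0 = *-pos p>0 (positive⁻¹ _ {{1/pos⇒pos q {{positive q>0}}}})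

  *-÷ : ∀ p q .{{_ : NonZero q}} → q * (p ÷ q) ≡ p
  *-÷ p q = begin
    q * (p * 1/ q)  ≡⟨ *-assoc q p _ ⟨
    q * p * 1/ q    ≡⟨ cong (_* 1/ q) (*-comm q p) ⟩
    p * q * 1/ q    ≡⟨ *-assoc p q _ ⟩
    p * (q * 1/ q)  ≡⟨ cong (p *_) (*-inverseʳ q) ⟩
    p * 1ℚ          ≡⟨ *-identityʳ p ⟩
    p               ∎
    where open ≡-Reasoning

  ≤÷⇒*≤ : ∀ {p q r} (r>0 : 0ℚ < r) → p ≤ (q ÷ r) {{>-nonZero r>0}} → p * r ≤ q
  ≤÷⇒*≤ {p} {q} {r} r>0 p≤q/r = subst (p * r ≤_) (trans (*-comm _ r) (*-÷ q r {{>-nonZero r>0}}))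
                                   (*-monoʳ-≤-nonNeg r {{nonNegative (<⇒≤ r>0)}} p≤q/r)

module Plane where

  open RationalSigns
  open import Defs using (Point; OnSeg)
  open import Data.Rational using (ℚ; 0ℚ; 1ℚ; _+_; _*_; _-_; -_; _<_; _≤_)
  open import Data.Rational.Properties
  open import Data.Rational.Solver
  open +-*-Solver using (solve; _:+_; _:*_; _:-_; :-_; _:=_; con)
  open import Data.Product using (_×_; _,_; Σ-syntax)
  open import Data.Product.Properties using (≡-dec)
  open import Relation.Binary.PropositionalEquality
  open import Relation.Nullary using (yes; no; Dec; contradiction)

  infixl 6 _-ᵥ_ _+ᵥ_
  infixl 5 _⊕_·_

  _-ᵥ_ : Point → Point → Point
  (px , py) -ᵥ (qx , qy) = (px - qx , py - qy)

  _+ᵥ_ : Point → Point → Point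
  (px , py) +ᵥ (qx , qy) = (px + qx , py + qy)

  -ᵥ_ : Point → Point
  -ᵥ (px , py) = (- px , - py)

  _⊕_·_ : Point → ℚ → Point → Point
  (px , py) ⊕ s · (dx , dy) = (px + s * dx , py + s * dy)

  cross : Point → Point → ℚ
  cross (ux , uy) (vx , vy) = ux * vy - uy * vx

  dot : Point → Point → ℚ
  dot (ux , uy) (vx , vy) = ux * vx + uy * vy

  orient : Point → Point → Point → ℚ
  orient A B C = cross (B -ᵥ A) (C -ᵥ A)

  sqLen : Point → Point → ℚ
  sqLen A B = dot (B -ᵥ A) (B -ᵥ A)

  proj : Point → Point → Point → ℚ
  proj A B P = dot (P -ᵥ A) (B -ᵥ A)

  _≟ₚ_ : (P Q : Point) → Dec (P ≡ Q)
  _≟ₚ_ = ≡-dec _≟_ _≟_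

  0<sqLen : ∀ A B → A ≢ B → 0ℚ < sqLen A B
  0<sqLen (ax , ay) (bx , by) A≢B with (bx - ax) ≟ 0ℚ | (by - ay) ≟ 0ℚ
  ... | yes ex | yes ey = contradiction (sym (cong₂ _,_ (p-q≡0⇒p≡q bx ax ex) (p-q≡0⇒p≡q by ay ey))) A≢B
  ... | no ex  | _      = +-pos (p≢0⇒0<p*p (bx - ax) ex) (0≤p*p (by - ay))
  ... | yes _  | no ey  =
    subst (0ℚ <_) (+-comm ((by - ay) * (by - ay)) _) (+-pos (p≢0⇒0<p*p (by - ay) ey) (0≤p*p (bx - ax)))

  Affine : Set
  Affine = ℚ × ℚ × ℚ

  eval : Affine → Point → ℚ
  eval (a , b , c) (x , y) = a * x + b * y + c

  linear : Affine → Point → ℚ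
  linear (a , b , c) (x , y) = a * x + b * y

  eval-⊕ : ∀ h P s d → eval h (P ⊕ s · d) ≡ eval h P + s * linear h d
  eval-⊕ (a , b , c) (px , py) s (dx , dy) = solve 8 (λ a b c px py s dx dy →
    a :* (px :+ s :* dx) :+ b :* (py :+ s :* dy) :+ c
    := (a :* px :+ b :* py :+ c) :+ s :* (a :* dx :+ b :* dy)) refl a b c px py s dx dy

  linear-ᵥ : ∀ h P Q → linear h (Q -ᵥ P) ≡ eval h Q - eval h P
  linear-ᵥ (a , b , c) (px , py) (qx , qy) = solve 7 (λ a b c px py qx qy →
    a :* (qx :- px) :+ b :* (qy :- py)
    := (a :* qx :+ b :* qy :+ c) :- (a :* px :+ b :* py :+ c)) refl a b c px py qx qy

  scale : ℚ → ℚ → Affine → Affine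
  scale α β (a , b , c) = (α * a , α * b , α * c + β)

  eval-scale : ∀ α β h t → eval (scale α β h) t ≡ α * eval h t + β
  eval-scale α β (a , b , c) (x , y) = solve 7 (λ α β a b c x y →
    α :* a :* x :+ α :* b :* y :+ (α :* c :+ β) := α :* (a :* x :+ b :* y :+ c) :+ β) refl α β a b c x y

  negate : Affine → Affine
  negate (a , b , c) = (- a , - b , - c)

  eval-negate : ∀ h t → eval (negate h) t ≡ - eval h t
  eval-negate (a , b , c) (x , y) = solve 5 (λ a b c x y →
    (:- a) :* x :+ (:- b) :* y :+ (:- c) := :- (a :* x :+ b :* y :+ c)) refl a b c x y

  lineThrough : Point → Point → Affine
  lineThrough (ax , ay) (bx , by) = (- (by - ay) , bx - ax , (by - ay) * ax - (bx - ax) * ay)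

  eval-lineThrough : ∀ A B t → eval (lineThrough A B) t ≡ orient A B t
  eval-lineThrough (ax , ay) (bx , by) (tx , ty) = solve 6 (λ ax ay bx by tx ty →
    (:- (by :- ay)) :* tx :+ (bx :- ax) :* ty :+ ((by :- ay) :* ax :- (bx :- ax) :* ay)
    := (bx :- ax) :* (ty :- ay) :- (by :- ay) :* (tx :- ax)) refl ax ay bx by tx ty

  projection : Point → Point → Affine
  projection (ax , ay) (bx , by) = (bx - ax , by - ay , - ((bx - ax) * ax + (by - ay) * ay))

  eval-projection : ∀ A B t → eval (projection A B) t ≡ proj A B t
  eval-projection (ax , ay) (bx , by) (tx , ty) = solve 6 (λ ax ay bx by tx ty →
    (bx :- ax) :* tx :+ (by :- ay) :* ty :+ (:- ((bx :- ax) :* ax :+ (by :- ay) :* ay))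
    := (tx :- ax) :* (bx :- ax) :+ (ty :- ay) :* (by :- ay)) refl ax ay bx by tx ty

  orient-start : ∀ A B → orient A B A ≡ 0ℚ
  orient-start (ax , ay) (bx , by) = solve 4 (λ ax ay bx by →
    (bx :- ax) :* (ay :- ay) :- (by :- ay) :* (ax :- ax) := con 0ℚ) refl ax ay bx by

  orient-end : ∀ A B → orient A B B ≡ 0ℚ
  orient-end (ax , ay) (bx , by) = solve 4 (λ ax ay bx by →
    (bx :- ax) :* (by :- ay) :- (by :- ay) :* (bx :- ax) := con 0ℚ) refl ax ay bx by

  proj-start : ∀ A B → proj A B A ≡ 0ℚ
  proj-start (ax , ay) (bx , by) = solve 4 (λ ax ay bx by →
    (ax :- ax) :* (bx :- ax) :+ (ay :- ay) :* (by :- ay) := con 0ℚ) refl ax ay bx by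

  ⊕-zero-scalar : ∀ P d → P ⊕ 0ℚ · d ≡ P
  ⊕-zero-scalar (px , py) (dx , dy) = cong₂ _,_ (solve 2 (λ p d → p :+ con 0ℚ :* d := p) refl px dx)
                                                  (solve 2 (λ p d → p :+ con 0ℚ :* d := p) refl py dy)

  ⊕-one : ∀ P Q → P ⊕ 1ℚ · (Q -ᵥ P) ≡ Q
  ⊕-one (px , py) (qx , qy) = cong₂ _,_ (solve 2 (λ p q → p :+ con 1ℚ :* (q :- p) := q) refl px qx)
                                         (solve 2 (λ p q → p :+ con 1ℚ :* (q :- p) := q) refl py qy)

  ⊕-zero-vector : ∀ P s → P ⊕ s · (0ℚ , 0ℚ) ≡ P
  ⊕-zero-vector (px , py) s = cong₂ _,_ (solve 2 (λ p s → p :+ s :* con 0ℚ := p) refl px s)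
                                   (solve 2 (λ p s → p :+ s :* con 0ℚ := p) refl py s)

  onSeg-start : ∀ A B → OnSeg A B A
  onSeg-start A B = 0ℚ , ≤-refl , <⇒≤ 0<1 , sym (⊕-zero-scalar A (B -ᵥ A))

  onSeg-end : ∀ A B → OnSeg A B B
  onSeg-end A B = 1ℚ , <⇒≤ 0<1 , ≤-refl , sym (⊕-one A B)

  onSeg-degenerate : ∀ {A t} → OnSeg A A t → t ≡ A
  onSeg-degenerate {A@(ax , ay)} (s , _ , _ , refl) = cong₂ _,_ (collapse ax) (collapse ay)
    where
    collapse : ∀ a → a + s * (a - a) ≡ a
    collapse a = solve 2 (λ a s → a :+ s :* (a :- a) := a) refl a s

  onSeg-sym : ∀ {P Q t} → OnSeg P Q t → OnSeg Q P t
  onSeg-sym {(px , py)} {(qx , qy)} (s , 0≤s , s≤1 , refl) =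
    1ℚ - s , p≤q⇒0≤q-p s≤1 ,
    0≤q-p⇒p≤q (subst (0ℚ ≤_) (solve 1 (λ s → s := con 1ℚ :- (con 1ℚ :- s)) refl s) 0≤s) ,
    cong₂ _,_ (flip px qx) (flip py qy)
    where
    flip : ∀ p q → p + s * (q - p) ≡ q + (1ℚ - s) * (p - q)
    flip p q = solve 3 (λ p q s → p :+ s :* (q :- p) := q :+ (con 1ℚ :- s) :* (p :- q)) refl p q s

  onSeg-eval : ∀ h {P Q t} → OnSeg P Q t →
    Σ[ s ∈ ℚ ] 0ℚ ≤ s × s ≤ 1ℚ × eval h t ≡ eval h P + s * (eval h Q - eval h P)
  onSeg-eval h {P} {Q} (s , 0≤s , s≤1 , refl) =
    s , 0≤s , s≤1 , trans (eval-⊕ h P s (Q -ᵥ P)) (cong (λ z → eval h P + s * z) (linear-ᵥ h P Q))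

  interpolate-pos : ∀ {s p q} → 0ℚ ≤ s → s ≤ 1ℚ → 0ℚ < p → 0ℚ < q → 0ℚ < p + s * (q - p)
  interpolate-pos {s} {p} {q} 0≤s s≤1 p>0 q>0 with sign s
  ... | <0 s<0 = contradiction 0≤s (<⇒≱ s<0)
  ... | ≡0 refl = subst (0ℚ <_) (solve 2 (λ p q → p := p :+ con 0ℚ :* (q :- p)) refl p q) p>0
  ... | >0 s>0 = subst (0ℚ <_) (solve 3 (λ p q s → s :* q :+ (con 1ℚ :- s) :* p := p :+ s :* (q :- p)) refl p q s)
                        (+-pos (*-pos s>0 q>0) (*-nonNeg (p≤q⇒0≤q-p s≤1) (<⇒≤ p>0)))

  onSeg-pos : ∀ h {P Q t} → OnSeg P Q t → 0ℚ < eval h P → 0ℚ < eval h Q → 0ℚ < eval h t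
  onSeg-pos h t∈PQ hP>0 hQ>0 with onSeg-eval h t∈PQ
  ... | s , 0≤s , s≤1 , e = subst (0ℚ <_) (sym e) (interpolate-pos 0≤s s≤1 hP>0 hQ>0)

  onSeg-neg : ∀ h {P Q t} → OnSeg P Q t → eval h P < 0ℚ → eval h Q < 0ℚ → eval h t < 0ℚ
  onSeg-neg h {P} {Q} {t} t∈PQ hP<0 hQ<0 = neg-cancel-< (subst (0ℚ <_) (eval-negate h t)
    (onSeg-pos (negate h) t∈PQ (flip P hP<0) (flip Q hQ<0)))
    where
    flip : ∀ X → eval h X < 0ℚ → 0ℚ < eval (negate h) X
    flip X hX<0 = subst (0ℚ <_) (sym (eval-negate h X)) (neg-antimono-< hX<0)

module Separation where

  open RationalSigns
  open Plane
  open import Defs using (Point; OnSeg)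
  open import Data.Rational using (ℚ; 0ℚ; 1ℚ; _+_; _*_; _-_; -_; _<_; _≤_; _÷_; ≢-nonZero)
  open import Data.Rational.Properties
  open import Data.Rational.Solver
  open +-*-Solver using (solve; _:+_; _:*_; _:-_; :-_; _:=_; con)
  open import Data.Product using (_×_; _,_; proj₁; proj₂; Σ-syntax)
  open import Data.Sum using (_⊎_; inj₁; inj₂)
  open import Data.Empty using (⊥)
  open import Relation.Binary.PropositionalEquality
  open import Relation.Nullary using (yes; no; contradiction)

  record Separated (A B C D : Point) : Set where
    constructor separated
    field
      line : Affine
      A<0  : eval line A < 0ℚ
      B<0  : eval line B < 0ℚ
      C>0  : 0ℚ < eval line C
      D>0  : 0ℚ < eval line D

  separated⇒disjoint : ∀ {A B C D t} → Separated A B C D → OnSeg A B t → OnSeg C D t → ⊥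
  separated⇒disjoint (separated h A<0 B<0 C>0 D>0) t∈AB t∈CD =
    <-asym (onSeg-neg h t∈AB A<0 B<0) (onSeg-pos h t∈CD C>0 D>0)

  Separated-swap : ∀ {A B C D} → Separated C D A B → Separated A B C D
  Separated-swap {A} {B} {C} {D} (separated h C<0 D<0 A>0 B>0) =
    separated (negate h) (flip⁻ A A>0) (flip⁻ B B>0) (flip⁺ C C<0) (flip⁺ D D<0)
    where
    flip⁻ : ∀ X → 0ℚ < eval h X → eval (negate h) X < 0ℚ
    flip⁻ X hX>0 = subst (_< 0ℚ) (sym (eval-negate h X)) (neg-antimono-< hX>0)
    flip⁺ : ∀ X → eval h X < 0ℚ → 0ℚ < eval (negate h) X
    flip⁺ X hX<0 = subst (0ℚ <_) (sym (eval-negate h X)) (neg-antimono-< hX<0)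

  Meet : Point → Point → Point → Point → Set
  Meet A B C D = Σ[ t ∈ Point ] OnSeg A B t × OnSeg C D t

  Meet-swap : ∀ {A B C D} → Meet C D A B → Meet A B C D
  Meet-swap (t , t∈CD , t∈AB) = t , t∈AB , t∈CD

  -- (c + d) F - c d takes the values c² at C and d² at D.
  separated-by : ∀ {A B C D} (F : Affine) {a b c d : ℚ} →
    eval F A ≡ a → eval F B ≡ b → eval F C ≡ c → eval F D ≡ d →
    0ℚ < c * d → (c + d) * a ≤ 0ℚ → (c + d) * b ≤ 0ℚ → Separated A B C D
  separated-by {A} {B} {C} {D} F {a} {b} {c} {d} FA FB FC FD cd>0 a≤0 b≤0 =
    separated h (below A FA a≤0) (below B FB b≤0)
      (subst (0ℚ <_) (sym (trans (eval-h C FC) (square-c c d))) (p≢0⇒0<p*p c c≢0))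
      (subst (0ℚ <_) (sym (trans (eval-h D FD) (square-d c d))) (p≢0⇒0<p*p d d≢0))
    where
    h = scale (c + d) (- (c * d)) F
    eval-h : ∀ P {v} → eval F P ≡ v → eval h P ≡ (c + d) * v + - (c * d)
    eval-h P {v} FP = trans (eval-scale (c + d) (- (c * d)) F P) (cong (λ z → (c + d) * z + - (c * d)) FP)
    below : ∀ P {v} → eval F P ≡ v → (c + d) * v ≤ 0ℚ → eval h P < 0ℚ
    below P {v} FP v≤0 = subst (_< 0ℚ) (sym (trans (eval-h P FP) (+-comm ((c + d) * v) (- (c * d)))))
      (+-neg-nonPos (neg-antimono-< cd>0) v≤0)
    square-c : ∀ x y → (x + y) * x + - (x * y) ≡ x * x
    square-c = solve 2 (λ x y → (x :+ y) :* x :+ (:- (x :* y)) := x :* x) refl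
    square-d : ∀ x y → (x + y) * y + - (x * y) ≡ y * y
    square-d = solve 2 (λ x y → (x :+ y) :* y :+ (:- (x :* y)) := y :* y) refl
    c≢0 : c ≢ 0ℚ
    c≢0 refl = <-irrefl (sym (*-zeroˡ d)) cd>0
    d≢0 : d ≢ 0ℚ
    d≢0 refl = <-irrefl (sym (*-zeroʳ c)) cd>0

  same-side⇒separated : ∀ A B C D → 0ℚ < orient A B C * orient A B D → Separated A B C D
  same-side⇒separated A B C D CD>0 = separated-by (lineThrough A B)
    (trans (eval-lineThrough A B A) (orient-start A B)) (trans (eval-lineThrough A B B) (orient-end A B))
    (eval-lineThrough A B C) (eval-lineThrough A B D) CD>0
    (≤-reflexive (*-zeroʳ (orient A B C + orient A B D))) (≤-reflexive (*-zeroʳ (orient A B C + orient A B D)))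

  record Root (o₁ o₂ : ℚ) : Set where
    constructor rootAt
    field
      s   : ℚ
      0≤s : 0ℚ ≤ s
      s≤1 : s ≤ 1ℚ
      eq  : (o₁ - o₂) * s ≡ o₁

  root : ∀ o₁ o₂ → o₁ ≢ o₂ → o₁ * o₂ ≤ 0ℚ → Root o₁ o₂
  root o₁ o₂ o₁≢o₂ o₁o₂≤0 = rootAt s 0≤s s≤1 δs≡o₁
    where
    δ = o₁ - o₂
    δ≢0 : δ ≢ 0ℚ
    δ≢0 δ≡0 = o₁≢o₂ (p-q≡0⇒p≡q o₁ o₂ δ≡0)
    s = (o₁ ÷ δ) {{≢-nonZero δ≢0}}
    δs≡o₁ : δ * s ≡ o₁
    δs≡o₁ = *-÷ o₁ δ {{≢-nonZero δ≢0}}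
    0<δδ : 0ℚ < δ * δ
    0<δδ = p≢0⇒0<p*p δ δ≢0
    0≤s : 0ℚ ≤ s
    0≤s = *-cancelʳ-nonNeg 0<δδ (subst (0ℚ ≤_) eq (+-nonNeg (0≤p*p o₁) (neg-antimono-≤ o₁o₂≤0)))
      where
      eq : o₁ * o₁ + - (o₁ * o₂) ≡ s * (δ * δ)
      eq = trans (solve 2 (λ o₁ o₂ → o₁ :* o₁ :+ (:- (o₁ :* o₂)) := o₁ :* (o₁ :- o₂)) refl o₁ o₂)
             (trans (cong (_* δ) (sym δs≡o₁))
               (solve 3 (λ s o₁ o₂ → ((o₁ :- o₂) :* s) :* (o₁ :- o₂) := s :* ((o₁ :- o₂) :* (o₁ :- o₂)))
                  refl s o₁ o₂))
    s≤1 : s ≤ 1ℚ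
    s≤1 = 0≤q-p⇒p≤q (*-cancelʳ-nonNeg 0<δδ (subst (0ℚ ≤_) eq (+-nonNeg (0≤p*p o₂) (neg-antimono-≤ o₁o₂≤0))))
      where
      eq : o₂ * o₂ + - (o₁ * o₂) ≡ (1ℚ - s) * (δ * δ)
      eq = trans (solve 2 (λ o₁ o₂ → o₂ :* o₂ :+ (:- (o₁ :* o₂)) := (o₁ :- o₂) :* (o₁ :- o₂) :- o₁ :* (o₁ :- o₂))
                    refl o₁ o₂)
             (trans (cong (λ z → δ * δ - z * δ) (sym δs≡o₁))
               (solve 3 (λ s o₁ o₂ → (o₁ :- o₂) :* (o₁ :- o₂) :- ((o₁ :- o₂) :* s) :* (o₁ :- o₂)
                                    := (con 1ℚ :- s) :* ((o₁ :- o₂) :* (o₁ :- o₂))) refl s o₁ o₂))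

  private
    crossing-coordinate : ∀ o₁ o₂ o₃ s r c e a f → o₁ ≢ o₂ →
      (o₁ - o₂) * c + o₁ * e - (o₁ - o₂) * a + o₃ * f ≡ 0ℚ →
      (o₁ - o₂) * s ≡ o₁ → (- (o₁ - o₂)) * r ≡ o₃ → c + s * e ≡ a + r * f
    crossing-coordinate o₁ o₂ o₃ s r c e a f o₁≢o₂ H Hs Hr =
      p-q≡0⇒p≡q _ _ (*-cancelˡ-≡0 δ≢0 (begin
        (o₁ - o₂) * ((c + s * e) - (a + r * f))
          ≡⟨ solve 9 (λ o₁ o₂ o₃ s r c e a f → (o₁ :- o₂) :* ((c :+ s :* e) :- (a :+ r :* f)) :=
               ((o₁ :- o₂) :* c :+ o₁ :* e :- (o₁ :- o₂) :* a :+ o₃ :* f)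
               :+ (e :* ((o₁ :- o₂) :* s :- o₁) :+ f :* ((:- (o₁ :- o₂)) :* r :- o₃))) refl o₁ o₂ o₃ s r c e a f ⟩
        ((o₁ - o₂) * c + o₁ * e - (o₁ - o₂) * a + o₃ * f) + (e * ((o₁ - o₂) * s - o₁) + f * ((- (o₁ - o₂)) * r - o₃))
          ≡⟨ cong₂ _+_ H (cong₂ (λ x y → e * x + f * y) (p≡q⇒p-q≡0 Hs) (p≡q⇒p-q≡0 Hr)) ⟩
        0ℚ + (e * 0ℚ + f * 0ℚ)
          ≡⟨ solve 2 (λ e f → con 0ℚ :+ (e :* con 0ℚ :+ f :* con 0ℚ) := con 0ℚ) refl e f ⟩
        0ℚ ∎))
      where
      open ≡-Reasoning
      δ≢0 : o₁ - o₂ ≢ 0ℚ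
      δ≢0 δ≡0 = o₁≢o₂ (p-q≡0⇒p≡q o₁ o₂ δ≡0)

  -- The crossing point is C + s (D - C) = A + r (B - A), where s and r are read off the orientations.
  opposite-sides⇒meet : ∀ A B C D → orient A B C ≢ orient A B D →
    orient A B C * orient A B D ≤ 0ℚ → orient C D A * orient C D B ≤ 0ℚ → Meet A B C D
  opposite-sides⇒meet A@(ax , ay) B@(bx , by) C@(cx , cy) D@(dx , dy) o₁≢o₂ o₁o₂≤0 o₃o₄≤0 =
    (cx + s * (dx - cx) , cy + s * (dy - cy)) ,
    (r , Root.0≤s R , Root.s≤1 R ,
      cong₂ _,_ (crossing-coordinate o₁ o₂ o₃ s r cx (dx - cx) ax (bx - ax) o₁≢o₂ Hx (Root.eq S) Hr)
                (crossing-coordinate o₁ o₂ o₃ s r cy (dy - cy) ay (by - ay) o₁≢o₂ Hy (Root.eq S) Hr)) ,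
    (s , Root.0≤s S , Root.s≤1 S , refl)
    where
    o₁ = orient A B C
    o₂ = orient A B D
    o₃ = orient C D A
    o₄ = orient C D B
    o₃-o₄ : o₃ - o₄ ≡ - (o₁ - o₂)
    o₃-o₄ = solve 8 (λ ax ay bx by cx cy dx dy →
       ((dx :- cx) :* (ay :- cy) :- (dy :- cy) :* (ax :- cx)) :- ((dx :- cx) :* (by :- cy) :- (dy :- cy) :* (bx :- cx))
       := :- (((bx :- ax) :* (cy :- ay) :- (by :- ay) :* (cx :- ax)) :- ((bx :- ax) :* (dy :- ay) :- (by :- ay) :* (dx :- ax))))
       refl ax ay bx by cx cy dx dy
    o₃≢o₄ : o₃ ≢ o₄
    o₃≢o₄ o₃≡o₄ = o₁≢o₂ (p-q≡0⇒p≡q o₁ o₂ (trans (sym (neg-involutive (o₁ - o₂)))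
                                            (cong -_ (trans (sym o₃-o₄) (p≡q⇒p-q≡0 o₃≡o₄)))))
    S = root o₁ o₂ o₁≢o₂ o₁o₂≤0
    R = root o₃ o₄ o₃≢o₄ o₃o₄≤0
    s = Root.s S
    r = Root.s R
    Hr : (- (o₁ - o₂)) * r ≡ o₃
    Hr = trans (cong (_* r) (sym o₃-o₄)) (Root.eq R)
    Hx : (o₁ - o₂) * cx + o₁ * (dx - cx) - (o₁ - o₂) * ax + o₃ * (bx - ax) ≡ 0ℚ
    Hx = solve 8 (λ ax ay bx by cx cy dx dy →
       (((bx :- ax) :* (cy :- ay) :- (by :- ay) :* (cx :- ax)) :- ((bx :- ax) :* (dy :- ay) :- (by :- ay) :* (dx :- ax))) :* cx
       :+ ((bx :- ax) :* (cy :- ay) :- (by :- ay) :* (cx :- ax)) :* (dx :- cx)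
       :- (((bx :- ax) :* (cy :- ay) :- (by :- ay) :* (cx :- ax)) :- ((bx :- ax) :* (dy :- ay) :- (by :- ay) :* (dx :- ax))) :* ax
       :+ ((dx :- cx) :* (ay :- cy) :- (dy :- cy) :* (ax :- cx)) :* (bx :- ax)
       := con 0ℚ) refl ax ay bx by cx cy dx dy
    Hy : (o₁ - o₂) * cy + o₁ * (dy - cy) - (o₁ - o₂) * ay + o₃ * (by - ay) ≡ 0ℚ
    Hy = solve 8 (λ ax ay bx by cx cy dx dy →
       (((bx :- ax) :* (cy :- ay) :- (by :- ay) :* (cx :- ax)) :- ((bx :- ax) :* (dy :- ay) :- (by :- ay) :* (dx :- ax))) :* cy
       :+ ((bx :- ax) :* (cy :- ay) :- (by :- ay) :* (cx :- ax)) :* (dy :- cy)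
       :- (((bx :- ax) :* (cy :- ay) :- (by :- ay) :* (cx :- ax)) :- ((bx :- ax) :* (dy :- ay) :- (by :- ay) :* (dx :- ax))) :* ay
       :+ ((dx :- cx) :* (ay :- cy) :- (dy :- cy) :* (ax :- cx)) :* (by :- ay)
       := con 0ℚ) refl ax ay bx by cx cy dx dy

  private
    collinear-x : ∀ A B P → orient A B P ≡ 0ℚ →
      sqLen A B * (proj₁ P - proj₁ A) - proj A B P * (proj₁ B - proj₁ A) ≡ 0ℚ
    collinear-x (ax , ay) (bx , by) (px , py) o≡0 =
      trans (solve 6 (λ ax ay bx by px py →
         ((bx :- ax) :* (bx :- ax) :+ (by :- ay) :* (by :- ay)) :* (px :- ax)
           :- ((px :- ax) :* (bx :- ax) :+ (py :- ay) :* (by :- ay)) :* (bx :- ax)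
         := :- ((by :- ay) :* ((bx :- ax) :* (py :- ay) :- (by :- ay) :* (px :- ax)))) refl ax ay bx by px py)
      (trans (cong (λ z → - ((by - ay) * z)) o≡0) (cong -_ (*-zeroʳ (by - ay))))

    collinear-y : ∀ A B P → orient A B P ≡ 0ℚ →
      sqLen A B * (proj₂ P - proj₂ A) - proj A B P * (proj₂ B - proj₂ A) ≡ 0ℚ
    collinear-y (ax , ay) (bx , by) (px , py) o≡0 =
      trans (solve 6 (λ ax ay bx by px py →
         ((bx :- ax) :* (bx :- ax) :+ (by :- ay) :* (by :- ay)) :* (py :- ay)
           :- ((px :- ax) :* (bx :- ax) :+ (py :- ay) :* (by :- ay)) :* (by :- ay)
         := (bx :- ax) :* ((bx :- ax) :* (py :- ay) :- (by :- ay) :* (px :- ax))) refl ax ay bx by px py)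
      (trans (cong ((bx - ax) *_) o≡0) (*-zeroʳ (bx - ax)))

    on-line-coordinate : ∀ L p a e s π → L ≢ 0ℚ → L * (p - a) - π * e ≡ 0ℚ → L * s ≡ π → p ≡ a + s * e
    on-line-coordinate L p a e s π L≢0 H Ls≡π = p-q≡0⇒p≡q _ _ (*-cancelˡ-≡0 L≢0 (begin
      L * (p - (a + s * e))               ≡⟨ solve 6 (λ L p a e s π → L :* (p :- (a :+ s :* e))
                                               := (L :* (p :- a) :- π :* e) :- e :* (L :* s :- π)) refl L p a e s π ⟩
      (L * (p - a) - π * e) - e * (L * s - π) ≡⟨ cong₂ (λ x y → x - e * y) H (p≡q⇒p-q≡0 Ls≡π) ⟩
      0ℚ - e * 0ℚ                          ≡⟨ solve 1 (λ e → con 0ℚ :- e :* con 0ℚ := con 0ℚ) refl e ⟩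
      0ℚ                                   ∎))
      where open ≡-Reasoning

    between-coordinate : ∀ L πc πd s c d a e → L ≢ 0ℚ → πc ≢ πd →
      L * (c - a) - πc * e ≡ 0ℚ → L * (d - a) - πd * e ≡ 0ℚ → (πc - πd) * s ≡ πc → a ≡ c + s * (d - c)
    between-coordinate L πc πd s c d a e L≢0 πc≢πd Hc Hd Hs =
      sym (p-q≡0⇒p≡q _ _ (*-cancelˡ-≡0 Lδ≢0 (begin
        (L * (πc - πd)) * ((c + s * (d - c)) - a)
          ≡⟨ solve 8 (λ L πc πd s c d a e → (L :* (πc :- πd)) :* ((c :+ s :* (d :- c)) :- a) :=
               (πc :- πd) :* (L :* (c :- a) :- πc :* e) :+ ((πc :- πd) :* s :- πc) :* (L :* (d :- a) :- L :* (c :- a))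
               :+ πc :* ((L :* (d :- a) :- πd :* e) :- (L :* (c :- a) :- πc :* e))) refl L πc πd s c d a e ⟩
        (πc - πd) * (L * (c - a) - πc * e) + ((πc - πd) * s - πc) * (L * (d - a) - L * (c - a))
          + πc * ((L * (d - a) - πd * e) - (L * (c - a) - πc * e))
          ≡⟨ cong₂ (λ x y → (πc - πd) * x + y * (L * (d - a) - L * (c - a)) + πc * ((L * (d - a) - πd * e) - x))
                   Hc (p≡q⇒p-q≡0 Hs) ⟩
        (πc - πd) * 0ℚ + 0ℚ * (L * (d - a) - L * (c - a)) + πc * ((L * (d - a) - πd * e) - 0ℚ)
          ≡⟨ cong (λ z → (πc - πd) * 0ℚ + 0ℚ * (L * (d - a) - L * (c - a)) + πc * (z - 0ℚ)) Hd ⟩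
        (πc - πd) * 0ℚ + 0ℚ * (L * (d - a) - L * (c - a)) + πc * (0ℚ - 0ℚ)
          ≡⟨ solve 3 (λ δ x πc → δ :* con 0ℚ :+ con 0ℚ :* x :+ πc :* (con 0ℚ :- con 0ℚ) := con 0ℚ)
               refl (πc - πd) (L * (d - a) - L * (c - a)) πc ⟩
        0ℚ ∎)))
      where
      open ≡-Reasoning
      Lδ≢0 : L * (πc - πd) ≢ 0ℚ
      Lδ≢0 e≡0 = πc≢πd (p-q≡0⇒p≡q πc πd (*-cancelˡ-≡0 L≢0 e≡0))

  collinear⇒onSeg : ∀ A B P → A ≢ B → orient A B P ≡ 0ℚ →
    0ℚ ≤ proj A B P → proj A B P ≤ sqLen A B → OnSeg A B P
  collinear⇒onSeg A@(ax , ay) B@(bx , by) P@(px , py) A≢B o≡0 0≤π π≤L =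
    s , 0≤s , s≤1 , cong₂ _,_ (on-line-coordinate L px ax (bx - ax) s π L≢0 (collinear-x A B P o≡0) Ls≡π)
                              (on-line-coordinate L py ay (by - ay) s π L≢0 (collinear-y A B P o≡0) Ls≡π)
    where
    L = sqLen A B
    π = proj A B P
    L>0 : 0ℚ < L
    L>0 = 0<sqLen A B A≢B
    L≢0 : L ≢ 0ℚ
    L≢0 L≡0 = <-irrefl (sym L≡0) L>0
    s = (π ÷ L) {{≢-nonZero L≢0}}
    Ls≡π : L * s ≡ π
    Ls≡π = *-÷ π L {{≢-nonZero L≢0}}
    0≤s : 0ℚ ≤ s
    0≤s = *-cancelʳ-nonNeg L>0 (subst (0ℚ ≤_) (trans (sym Ls≡π) (*-comm L s)) 0≤π)
    s≤1 : s ≤ 1ℚ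
    s≤1 = 0≤q-p⇒p≤q (*-cancelʳ-nonNeg L>0 (subst (0ℚ ≤_) eq (p≤q⇒0≤q-p π≤L)))
      where
      eq : L - π ≡ (1ℚ - s) * L
      eq = trans (cong (λ z → L - z) (sym Ls≡π)) (solve 2 (λ L s → L :- L :* s := (con 1ℚ :- s) :* L) refl L s)

  collinear-straddle⇒onSeg : ∀ A B C D → A ≢ B → orient A B C ≡ 0ℚ → orient A B D ≡ 0ℚ →
    proj A B C * proj A B D ≤ 0ℚ → proj A B C ≢ proj A B D → OnSeg C D A
  collinear-straddle⇒onSeg A@(ax , ay) B@(bx , by) C@(cx , cy) D@(dx , dy) A≢B oC oD πcπd≤0 πc≢πd =
    s , Root.0≤s S , Root.s≤1 S ,
    cong₂ _,_ (between-coordinate L πc πd s cx dx ax (bx - ax) L≢0 πc≢πd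
                 (collinear-x A B C oC) (collinear-x A B D oD) (Root.eq S))
              (between-coordinate L πc πd s cy dy ay (by - ay) L≢0 πc≢πd
                 (collinear-y A B C oC) (collinear-y A B D oD) (Root.eq S))
    where
    L = sqLen A B
    πc = proj A B C
    πd = proj A B D
    L≢0 : L ≢ 0ℚ
    L≢0 L≡0 = <-irrefl (sym L≡0) (0<sqLen A B A≢B)
    S = root πc πd πc≢πd πcπd≤0
    s = Root.s S

  data Position (v L : ℚ) : Set where
    before : v < 0ℚ → Position v L
    within : 0ℚ ≤ v → v ≤ L → Position v L
    beyond : L < v → Position v L

  position : ∀ v L → Position v L
  position v L with sign v | v ≤? L
  ... | <0 v<0  | _       = before v<0
  ... | ≡0 v≡0  | yes v≤L = within (≤-reflexive (sym v≡0)) v≤L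
  ... | >0 v>0  | yes v≤L = within (<⇒≤ v>0) v≤L
  ... | ≡0 _    | no  v≰L = beyond (≰⇒> v≰L)
  ... | >0 _    | no  v≰L = beyond (≰⇒> v≰L)

  proj-reverse : ∀ A B P → proj B A P ≡ sqLen A B - proj A B P
  proj-reverse (ax , ay) (bx , by) (px , py) = solve 6 (λ ax ay bx by px py →
    (px :- bx) :* (ax :- bx) :+ (py :- by) :* (ay :- by)
    := ((bx :- ax) :* (bx :- ax) :+ (by :- ay) :* (by :- ay)) :- ((px :- ax) :* (bx :- ax) :+ (py :- ay) :* (by :- ay)))
    refl ax ay bx by px py

  before-start⇒separated : ∀ A B C D → A ≢ B → proj A B C < 0ℚ → proj A B D < 0ℚ → Separated A B C D
  before-start⇒separated A B C D A≢B πc<0 πd<0 = separated-by (projection A B)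
    (trans (eval-projection A B A) (proj-start A B)) (eval-projection A B B)
    (eval-projection A B C) (eval-projection A B D) (*-neg-neg πc<0 πd<0)
    (≤-reflexive (*-zeroʳ (proj A B C + proj A B D)))
    (<⇒≤ (*-neg-pos (+-neg πc<0 πd<0) (0<sqLen A B A≢B)))

  collinear⇒separated⊎meet : ∀ A B C D → A ≢ B → orient A B C ≡ 0ℚ → orient A B D ≡ 0ℚ →
    Separated A B C D ⊎ Meet A B C D
  collinear⇒separated⊎meet A B C D A≢B oC oD with position (proj A B C) (sqLen A B) | position (proj A B D) (sqLen A B)
  ... | within 0≤πc πc≤L | _ = inj₂ (C , collinear⇒onSeg A B C A≢B oC 0≤πc πc≤L , onSeg-start C D)
  ... | before _ | within 0≤πd πd≤L = inj₂ (D , collinear⇒onSeg A B D A≢B oD 0≤πd πd≤L , onSeg-end C D)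
  ... | beyond _ | within 0≤πd πd≤L = inj₂ (D , collinear⇒onSeg A B D A≢B oD 0≤πd πd≤L , onSeg-end C D)
  ... | before πc<0 | before πd<0 = inj₁ (before-start⇒separated A B C D A≢B πc<0 πd<0)
  ... | beyond πc>L | beyond πd>L = inj₁ (record { line = line ; A<0 = B<0 ; B<0 = A<0 ; C>0 = C>0 ; D>0 = D>0 })
    where
    behind : ∀ P → sqLen A B < proj A B P → proj B A P < 0ℚ
    behind P πp>L = subst (_< 0ℚ) (sym (proj-reverse A B P)) (neg-cancel-< (subst (0ℚ <_) (flip (proj A B P)) (p<q⇒0<q-p πp>L)))
      where
      flip : ∀ p → p - sqLen A B ≡ - (sqLen A B - p)
      flip p = solve 2 (λ p L → p :- L := :- (L :- p)) refl p (sqLen A B)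
    open Separated (before-start⇒separated B A C D (λ B≡A → A≢B (sym B≡A)) (behind C πc>L) (behind D πd>L))
  ... | before πc<0 | beyond πd>L = inj₂ (A , onSeg-start A B ,
    collinear-straddle⇒onSeg A B C D A≢B oC oD (<⇒≤ (*-neg-pos πc<0 πd>0))
      (λ πc≡πd → <-asym πc<0 (subst (0ℚ <_) (sym πc≡πd) πd>0)))
    where πd>0 = <-trans (0<sqLen A B A≢B) πd>L
  ... | beyond πc>L | before πd<0 = inj₂ (A , onSeg-start A B ,
    collinear-straddle⇒onSeg A B C D A≢B oC oD (<⇒≤ (*-pos-neg πc>0 πd<0))
      (λ πc≡πd → <-asym πd<0 (subst (0ℚ <_) πc≡πd πc>0)))
    where πc>0 = <-trans (0<sqLen A B A≢B) πc>L

  private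
    separated⊎meet-nondegenerate : ∀ A B C D → A ≢ B → Separated A B C D ⊎ Meet A B C D
    separated⊎meet-nondegenerate A B C D A≢B = by-signs (sign (orient A B C * orient A B D)) (sign (orient C D A * orient C D B))
      where
      weakly-opposite : orient A B C * orient A B D ≤ 0ℚ → orient C D A * orient C D B ≤ 0ℚ →
        Separated A B C D ⊎ Meet A B C D
      weakly-opposite oAB≤0 oCD≤0 with orient A B C ≟ orient A B D
      ... | no oC≢oD = inj₂ (opposite-sides⇒meet A B C D oC≢oD oAB≤0 oCD≤0)
      ... | yes oC≡oD = collinear⇒separated⊎meet A B C D A≢B oC≡0 (trans (sym oC≡oD) oC≡0)
        where
        oC≡0 : orient A B C ≡ 0ℚ
        oC≡0 = p*p≤0⇒p≡0 (orient A B C) (subst (λ z → orient A B C * z ≤ 0ℚ) (sym oC≡oD) oAB≤0)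
      by-signs : Sign (orient A B C * orient A B D) → Sign (orient C D A * orient C D B) → Separated A B C D ⊎ Meet A B C D
      by-signs (>0 oAB>0) _          = inj₁ (same-side⇒separated A B C D oAB>0)
      by-signs (<0 _)     (>0 oCD>0) = inj₁ (Separated-swap (same-side⇒separated C D A B oCD>0))
      by-signs (≡0 _)     (>0 oCD>0) = inj₁ (Separated-swap (same-side⇒separated C D A B oCD>0))
      by-signs (<0 oAB<0) (<0 oCD<0) = weakly-opposite (<⇒≤ oAB<0) (<⇒≤ oCD<0)
      by-signs (<0 oAB<0) (≡0 oCD≡0) = weakly-opposite (<⇒≤ oAB<0) (≤-reflexive oCD≡0)
      by-signs (≡0 oAB≡0) (<0 oCD<0) = weakly-opposite (≤-reflexive oAB≡0) (<⇒≤ oCD<0)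
      by-signs (≡0 oAB≡0) (≡0 oCD≡0) = weakly-opposite (≤-reflexive oAB≡0) (≤-reflexive oCD≡0)

  separated⊎meet : ∀ A B C D → Separated A B C D ⊎ Meet A B C D
  separated⊎meet A B C D with A ≟ₚ B | C ≟ₚ D
  ... | no A≢B   | _        = separated⊎meet-nondegenerate A B C D A≢B
  ... | yes refl | no C≢D with separated⊎meet-nondegenerate C D A A C≢D
  ...   | inj₁ sep  = inj₁ (Separated-swap sep)
  ...   | inj₂ meet = inj₂ (Meet-swap {A} {A} {C} {D} meet)
  separated⊎meet A B C D | yes refl | yes refl with A ≟ₚ C
  ... | yes refl = inj₂ (A , onSeg-start A A , onSeg-start A A)
  ... | no A≢C = inj₁ (separated-by (projection A C) A↦0 A↦0 (eval-projection A C C) (eval-projection A C C)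
                        (*-pos L>0 L>0) (≤-reflexive (*-zeroʳ (L + L))) (≤-reflexive (*-zeroʳ (L + L))))
    where
    L = sqLen A C
    L>0 : 0ℚ < L
    L>0 = 0<sqLen A C A≢C
    A↦0 : eval (projection A C) A ≡ 0ℚ
    A↦0 = trans (eval-projection A C A) (proj-start A C)

  record SeparatedAt (X P Q : Point) : Set where
    constructor separatedAt
    field
      line : Affine
      X↦0  : eval line X ≡ 0ℚ
      P<0  : eval line P < 0ℚ
      Q>0  : 0ℚ < eval line Q

  SeparatedAt-swap : ∀ {X P Q} → SeparatedAt X Q P → SeparatedAt X P Q
  SeparatedAt-swap {X} {P} {Q} (separatedAt h X↦0 Q<0 P>0) = separatedAt (negate h)
    (trans (eval-negate h X) (cong -_ X↦0))
    (subst (_< 0ℚ) (sym (eval-negate h P)) (neg-antimono-< P>0))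
    (subst (0ℚ <_) (sym (eval-negate h Q)) (neg-antimono-< Q<0))

  separatedAt⇒meet-at-apex : ∀ {X P Q t} → SeparatedAt X P Q → OnSeg X P t → OnSeg X Q t → t ≡ X
  separatedAt⇒meet-at-apex {X} {P} {Q} (separatedAt h X↦0 P<0 Q>0) (s , 0≤s , _ , refl) t∈XQ with sign s
  ... | <0 s<0 = contradiction 0≤s (<⇒≱ s<0)
  ... | ≡0 refl = ⊕-zero-scalar X (P -ᵥ X)
  ... | >0 s>0 with onSeg-eval h t∈XQ
  ...   | r , 0≤r , _ , ht≡ =
    contradiction (subst (0ℚ ≤_) (sym (trans ht≡ (from-apex r (eval h Q)))) (*-nonNeg 0≤r (<⇒≤ Q>0)))
                                            (<⇒≱ (subst (_< 0ℚ) (sym ht<0) (*-pos-neg s>0 P<0)))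
    where
    from-apex : ∀ r v → eval h X + r * (v - eval h X) ≡ r * v
    from-apex r v = trans (cong (λ z → z + r * (v - z)) X↦0)
                          (solve 2 (λ r v → con 0ℚ :+ r :* (v :- con 0ℚ) := r :* v) refl r v)
    ht<0 : eval h (X ⊕ s · (P -ᵥ X)) ≡ s * eval h P
    ht<0 = trans (eval-⊕ h X s (P -ᵥ X)) (trans (cong (λ z → eval h X + s * z) (linear-ᵥ h X P)) (from-apex s (eval h P)))

  NotSameDirection : Point → Point → Set
  NotSameDirection u v = cross u v ≢ 0ℚ ⊎ dot u v < 0ℚ

  private
    lagrange : ∀ X P Q → proj X Q P * proj X Q P + orient X P Q * orient X P Q ≡ sqLen X P * sqLen X Q
    lagrange (xx , xy) (px , py) (qx , qy) = solve 6 (λ xx xy px py qx qy →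
      ((px :- xx) :* (qx :- xx) :+ (py :- xy) :* (qy :- xy)) :* ((px :- xx) :* (qx :- xx) :+ (py :- xy) :* (qy :- xy))
      :+ ((px :- xx) :* (qy :- xy) :- (py :- xy) :* (qx :- xx)) :* ((px :- xx) :* (qy :- xy) :- (py :- xy) :* (qx :- xx))
      := ((px :- xx) :* (px :- xx) :+ (py :- xy) :* (py :- xy)) :* ((qx :- xx) :* (qx :- xx) :+ (qy :- xy) :* (qy :- xy)))
      refl xx xy px py qx qy

    orient-swap : ∀ X P Q → orient X Q P ≡ - orient X P Q
    orient-swap (xx , xy) (px , py) (qx , qy) = solve 6 (λ xx xy px py qx qy →
      (qx :- xx) :* (py :- xy) :- (qy :- xy) :* (px :- xx) := :- ((px :- xx) :* (qy :- xy) :- (py :- xy) :* (qx :- xx)))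
      refl xx xy px py qx qy

    proj-swap : ∀ X P Q → proj X Q P ≡ proj X P Q
    proj-swap (xx , xy) (px , py) (qx , qy) = solve 6 (λ xx xy px py qx qy →
      (px :- xx) :* (qx :- xx) :+ (py :- xy) :* (qy :- xy) := (qx :- xx) :* (px :- xx) :+ (qy :- xy) :* (py :- xy))
      refl xx xy px py qx qy

    -- For collinear X P Q with d = proj X Q P > |XQ|², Lagrange's identity gives (|XP|² - d) |XQ|² = d (d - |XQ|²) > 0.
    collinear-beyond : ∀ X P Q → X ≢ Q → orient X P Q ≡ 0ℚ → sqLen X Q < proj X Q P → proj X Q P ≤ sqLen X P
    collinear-beyond X P Q X≢Q o≡0 W<d =
      <⇒≤ (0<q-p⇒p<q (*-cancelʳ-pos W>0 (subst (0ℚ <_) (sym identity) (*-pos d>0 (p<q⇒0<q-p W<d)))))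
      where
      d = proj X Q P
      U = sqLen X P
      W = sqLen X Q
      k = orient X P Q
      W>0 : 0ℚ < W
      W>0 = 0<sqLen X Q X≢Q
      d>0 : 0ℚ < d
      d>0 = <-trans W>0 W<d
      identity : (U - d) * W ≡ d * (d - W)
      identity = begin
        (U - d) * W                             ≡⟨ solve 4 (λ U W d k → (U :- d) :* W
                                                     := d :* (d :- W) :+ (U :* W :- (d :* d :+ k :* k)) :+ k :* k) refl U W d k ⟩
        d * (d - W) + (U * W - (d * d + k * k)) + k * k ≡⟨ cong₂ (λ x y → d * (d - W) + x + y)
                                                              (p≡q⇒p-q≡0 (sym (lagrange X P Q))) (cong (_* k) o≡0) ⟩
        d * (d - W) + 0ℚ + 0ℚ * k              ≡⟨ solve 2 (λ x k → x :+ con 0ℚ :+ con 0ℚ :* k := x) refl (d * (d - W)) k ⟩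
        d * (d - W)                             ∎
        where open ≡-Reasoning

    same-direction⇒nested : ∀ X P Q → X ≢ P → X ≢ Q → orient X P Q ≡ 0ℚ → 0ℚ ≤ proj X Q P →
      OnSeg X Q P ⊎ OnSeg X P Q
    same-direction⇒nested X P Q X≢P X≢Q o≡0 0≤d with proj X Q P ≤? sqLen X Q
    ... | yes d≤W = inj₁ (collinear⇒onSeg X Q P X≢Q (trans (orient-swap X P Q) (cong -_ o≡0)) 0≤d d≤W)
    ... | no  d≰W = inj₂ (collinear⇒onSeg X P Q X≢P o≡0
                      (subst (0ℚ ≤_) (proj-swap X P Q) (<⇒≤ (<-trans (0<sqLen X Q X≢Q) (≰⇒> d≰W))))
                      (subst (_≤ sqLen X P) (proj-swap X P Q) (collinear-beyond X P Q X≢Q o≡0 (≰⇒> d≰W))))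

  notSameDirection⊎nested : ∀ X P Q → X ≢ P → X ≢ Q →
    NotSameDirection (P -ᵥ X) (Q -ᵥ X) ⊎ (OnSeg X Q P ⊎ OnSeg X P Q)
  notSameDirection⊎nested X P Q X≢P X≢Q with orient X P Q ≟ 0ℚ
  ... | no o≢0 = inj₁ (inj₁ o≢0)
  ... | yes o≡0 with sign (proj X Q P)
  ...   | <0 d<0 = inj₁ (inj₂ d<0)
  ...   | ≡0 d≡0 = inj₂ (same-direction⇒nested X P Q X≢P X≢Q o≡0 (≤-reflexive (sym d≡0)))
  ...   | >0 d>0 = inj₂ (same-direction⇒nested X P Q X≢P X≢Q o≡0 (<⇒≤ d>0))

  private
    -- The line through X and P + Q - X, the diagonal of the parallelogram spanned at X.
    diagonal-separates : ∀ X P Q → 0ℚ < orient X P Q → SeparatedAt X P Q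
    diagonal-separates X@(xx , xy) P@(px , py) Q@(qx , qy) k>0 = separatedAt (lineThrough X B)
      (trans (eval-lineThrough X B X) (orient-start X B))
      (subst (_< 0ℚ) (sym (trans (eval-lineThrough X B P) orient-P)) (neg-antimono-< k>0))
      (subst (0ℚ <_) (sym (trans (eval-lineThrough X B Q) orient-Q)) k>0)
      where
      B = (px + qx - xx , py + qy - xy)
      orient-P : orient X B P ≡ - orient X P Q
      orient-P = solve 6 (λ xx xy px py qx qy →
        ((px :+ qx :- xx) :- xx) :* (py :- xy) :- ((py :+ qy :- xy) :- xy) :* (px :- xx)
        := :- ((px :- xx) :* (qy :- xy) :- (py :- xy) :* (qx :- xx))) refl xx xy px py qx qy
      orient-Q : orient X B Q ≡ orient X P Q
      orient-Q = solve 6 (λ xx xy px py qx qy →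
        ((px :+ qx :- xx) :- xx) :* (qy :- xy) :- ((py :+ qy :- xy) :- xy) :* (qx :- xx)
        := (px :- xx) :* (qy :- xy) :- (py :- xy) :* (qx :- xx)) refl xx xy px py qx qy

  notSameDirection⇒separatedAt : ∀ X P Q → X ≢ Q → NotSameDirection (P -ᵥ X) (Q -ᵥ X) → SeparatedAt X P Q
  notSameDirection⇒separatedAt X P Q X≢Q (inj₁ o≢0) with sign (orient X P Q)
  ... | <0 o<0 = SeparatedAt-swap (diagonal-separates X Q P (subst (0ℚ <_) (sym (orient-swap X P Q)) (neg-antimono-< o<0)))
  ... | ≡0 o≡0 = contradiction o≡0 o≢0
  ... | >0 o>0 = diagonal-separates X P Q o>0
  notSameDirection⇒separatedAt X P Q X≢Q (inj₂ d<0) = separatedAt (projection X Q)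
    (trans (eval-projection X Q X) (proj-start X Q))
    (subst (_< 0ℚ) (sym (eval-projection X Q P)) d<0)
    (subst (0ℚ <_) (sym (eval-projection X Q Q)) (0<sqLen X Q X≢Q))

  Degenerate : Point → Point → Point → Set
  Degenerate X P Q = X ≡ P ⊎ X ≡ Q ⊎ OnSeg X Q P ⊎ OnSeg X P Q

  separatedAt⊎degenerate : ∀ X P Q → SeparatedAt X P Q ⊎ Degenerate X P Q
  separatedAt⊎degenerate X P Q with X ≟ₚ P | X ≟ₚ Q
  ... | yes X≡P | _       = inj₂ (inj₁ X≡P)
  ... | no  _   | yes X≡Q = inj₂ (inj₂ (inj₁ X≡Q))
  ... | no  X≢P | no  X≢Q with notSameDirection⊎nested X P Q X≢P X≢Q
  ...   | inj₁ nsd           = inj₁ (notSameDirection⇒separatedAt X P Q X≢Q nsd)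
  ...   | inj₂ (inj₁ P∈XQ)   = inj₂ (inj₂ (inj₂ (inj₁ P∈XQ)))
  ...   | inj₂ (inj₂ Q∈XP)   = inj₂ (inj₂ (inj₂ (inj₂ Q∈XP)))

module Perturbation where

  open RationalSigns
  open Plane
  open Separation
  open import Defs using (Point)
  open import Data.Rational using (ℚ; 0ℚ; 1ℚ; _+_; _*_; _-_; -_; _<_; _≤_; _⊓_; _÷_; positive; nonNegative; >-nonZero)
  open import Data.Rational.Properties
  open import Data.Rational.Solver
  open +-*-Solver using (solve; _:+_; _:*_; _:-_; :-_; _:=_; con)
  open import Data.Product using (_,_)
  open import Relation.Binary.PropositionalEquality

  sqNorm : Point → ℚ
  sqNorm (x , y) = x * x + y * y

  size : Affine → ℚ
  size (a , b , c) = 1ℚ + (a * a + b * b)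

  0<size : ∀ h → 0ℚ < size h
  0<size (a , b , c) = +-pos 0<1 (+-nonNeg (0≤p*p a) (0≤p*p b))

  -- Twice the gap is a sum of squares plus 2.
  linear<size : ∀ h d → linear h d < size h * (1ℚ + sqNorm d)
  linear<size (a , b , c) (x , y) = 0<q-p⇒p<q (*-cancelʳ-pos 0<2 (subst (0ℚ <_) (sym gap) gap>0))
    where
    2ℚ = 1ℚ + 1ℚ
    0<2 : 0ℚ < 2ℚ
    0<2 = +-pos 0<1 (<⇒≤ 0<1)
    sum-of-squares : ℚ
    sum-of-squares = 2ℚ + (2ℚ * ((a * a + b * b) * (x * x + y * y))
                     + ((a - x) * (a - x) + a * a + x * x + ((b - y) * (b - y) + b * b + y * y)))
    gap : ((1ℚ + (a * a + b * b)) * (1ℚ + (x * x + y * y)) - (a * x + b * y)) * 2ℚ ≡ sum-of-squares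
    gap = solve 4 (λ a b x y →
      (((con 1ℚ :+ (a :* a :+ b :* b)) :* (con 1ℚ :+ (x :* x :+ y :* y))) :- (a :* x :+ b :* y)) :* (con 1ℚ :+ con 1ℚ)
      := (con 1ℚ :+ con 1ℚ) :+ ((con 1ℚ :+ con 1ℚ) :* ((a :* a :+ b :* b) :* (x :* x :+ y :* y))
         :+ ((a :- x) :* (a :- x) :+ a :* a :+ x :* x :+ ((b :- y) :* (b :- y) :+ b :* b :+ y :* y)))) refl a b x y
    gap>0 : 0ℚ < sum-of-squares
    gap>0 = +-pos 0<2 (+-nonNeg
      (*-nonNeg (<⇒≤ 0<2) (*-nonNeg (+-nonNeg (0≤p*p a) (0≤p*p b)) (+-nonNeg (0≤p*p x) (0≤p*p y))))
      (+-nonNeg (+-nonNeg (+-nonNeg (0≤p*p (a - x)) (0≤p*p a)) (0≤p*p x))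
                (+-nonNeg (+-nonNeg (0≤p*p (b - y)) (0≤p*p b)) (0≤p*p y))))

  -linear<size : ∀ h d → - linear h d < size h * (1ℚ + sqNorm d)
  -linear<size h@(a , b , c) d@(x , y) = subst₂ _<_
    (solve 4 (λ a b x y → (:- a) :* x :+ (:- b) :* y := :- (a :* x :+ b :* y)) refl a b x y)
    (cong (λ z → (1ℚ + z) * (1ℚ + sqNorm d)) (solve 2 (λ a b → (:- a) :* (:- a) :+ (:- b) :* (:- b) := a :* a :+ b :* b) refl a b))
    (linear<size (negate h) d)

  record Displaced (ε K : ℚ) (P P′ : Point) : Set where
    constructor displaced
    field
      d    : Point
      d≤K  : 1ℚ + sqNorm d ≤ K
      P′≡  : P′ ≡ P ⊕ ε · d

  private
    shrink : ∀ {ε K} h d → 0ℚ < ε → 1ℚ + sqNorm d ≤ K → ε * (size h * (1ℚ + sqNorm d)) ≤ ε * (size h * K)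
    shrink {ε} h d ε>0 d≤K = *-monoˡ-≤-nonNeg ε {{nonNegative (<⇒≤ ε>0)}}
                              (*-monoˡ-≤-nonNeg (size h) {{nonNegative (<⇒≤ (0<size h))}} d≤K)

    step : ∀ {ε} {x y} → 0ℚ < ε → x < y → ε * x < ε * y
    step {ε} ε>0 x<y = *-monoʳ-<-pos ε {{positive ε>0}} x<y

  displaced-neg : ∀ {ε K P P′} h → 0ℚ < ε → Displaced ε K P P′ →
    ε * (size h * K) ≤ - eval h P → eval h P′ < 0ℚ
  displaced-neg {ε} {K} {P} h ε>0 (displaced d d≤K refl) small =
    subst (_< 0ℚ) (sym (eval-⊕ h P ε d))
      (subst (eval h P + ε * linear h d <_) (+-inverseʳ (eval h P))
        (+-monoʳ-< (eval h P) (<-≤-trans (step ε>0 (linear<size h d)) (≤-trans (shrink h d ε>0 d≤K) small))))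

  displaced-pos : ∀ {ε K P P′} h → 0ℚ < ε → Displaced ε K P P′ →
    ε * (size h * K) ≤ eval h P → 0ℚ < eval h P′
  displaced-pos {ε} {K} {P} h ε>0 (displaced d d≤K refl) small =
    subst (0ℚ <_) (trans (solve 3 (λ v e l → v :- e :* (:- l) := v :+ e :* l) refl (eval h P) ε (linear h d))
                         (sym (eval-⊕ h P ε d)))
      (p<q⇒0<q-p (<-≤-trans (step ε>0 (-linear<size h d)) (≤-trans (shrink h d ε>0 d≤K) small)))

  margin : ∀ {A B C D} → Separated A B C D → ℚ
  margin {A} {B} {C} {D} (separated h _ _ _ _) = ((- eval h A) ⊓ (- eval h B)) ⊓ (eval h C ⊓ eval h D)

  marginAt : ∀ {X P Q} → SeparatedAt X P Q → ℚ
  marginAt {X} {P} {Q} (separatedAt h _ _ _) = (- eval h P) ⊓ eval h Q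

  0<margin : ∀ {A B C D} (s : Separated A B C D) → 0ℚ < margin s
  0<margin (separated h A<0 B<0 C>0 D>0) =
    ⊓-pos (⊓-pos (neg-antimono-< A<0) (neg-antimono-< B<0)) (⊓-pos C>0 D>0)

  0<marginAt : ∀ {X P Q} (s : SeparatedAt X P Q) → 0ℚ < marginAt s
  0<marginAt (separatedAt h _ P<0 Q>0) = ⊓-pos (neg-antimono-< P<0) Q>0

  tolerance : ∀ {A B C D} K → 0ℚ < K → Separated A B C D → ℚ
  tolerance K K>0 s = (margin s ÷ (size (Separated.line s) * K)) {{>-nonZero (*-pos (0<size (Separated.line s)) K>0)}}

  0<tolerance : ∀ {A B C D} K (K>0 : 0ℚ < K) (s : Separated A B C D) → 0ℚ < tolerance K K>0 s
  0<tolerance K K>0 s = ÷-pos (0<margin s) (*-pos (0<size (Separated.line s)) K>0)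

  toleranceAt : ∀ {X P Q} K → 0ℚ < K → SeparatedAt X P Q → ℚ
  toleranceAt K K>0 s = (marginAt s ÷ (size (SeparatedAt.line s) * K)) {{>-nonZero (*-pos (0<size (SeparatedAt.line s)) K>0)}}

  0<toleranceAt : ∀ {X P Q} K (K>0 : 0ℚ < K) (s : SeparatedAt X P Q) → 0ℚ < toleranceAt K K>0 s
  0<toleranceAt K K>0 s = ÷-pos (0<marginAt s) (*-pos (0<size (SeparatedAt.line s)) K>0)

  Separated-displaced : ∀ {ε K A B C D A′ B′ C′ D′} (K>0 : 0ℚ < K) (s : Separated A B C D) →
    0ℚ < ε → ε ≤ tolerance K K>0 s →
    Displaced ε K A A′ → Displaced ε K B B′ → Displaced ε K C C′ → Displaced ε K D D′ → Separated A′ B′ C′ D′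
  Separated-displaced {ε} {K} {A} {B} {C} {D} K>0 (separated h _ _ _ _) ε>0 ε≤ A′ B′ C′ D′ =
    separated h (displaced-neg h ε>0 A′ (≤-trans small (≤-trans (p⊓q≤p ab cd) (p⊓q≤p a b))))
                (displaced-neg h ε>0 B′ (≤-trans small (≤-trans (p⊓q≤p ab cd) (p⊓q≤q a b))))
                (displaced-pos h ε>0 C′ (≤-trans small (≤-trans (p⊓q≤q ab cd) (p⊓q≤p c d))))
                (displaced-pos h ε>0 D′ (≤-trans small (≤-trans (p⊓q≤q ab cd) (p⊓q≤q c d))))
    where
    a = - eval h A
    b = - eval h B
    c = eval h C
    d = eval h D
    ab = a ⊓ b
    cd = c ⊓ d
    small : ε * (size h * K) ≤ ab ⊓ cd
    small = ≤÷⇒*≤ (*-pos (0<size h) K>0) ε≤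

  SeparatedAt-displaced : ∀ {ε K X P Q P′ Q′} (K>0 : 0ℚ < K) (s : SeparatedAt X P Q) →
    0ℚ < ε → ε ≤ toleranceAt K K>0 s → Displaced ε K P P′ → Displaced ε K Q Q′ → SeparatedAt X P′ Q′
  SeparatedAt-displaced {ε} {K} {P = P} {Q} K>0 (separatedAt h X↦0 _ _) ε>0 ε≤ P′ Q′ =
    separatedAt h X↦0 (displaced-neg h ε>0 P′ (≤-trans small (p⊓q≤p (- eval h P) (eval h Q))))
                      (displaced-pos h ε>0 Q′ (≤-trans small (p⊓q≤q (- eval h P) (eval h Q))))
    where
    small : ε * (size h * K) ≤ (- eval h P) ⊓ eval h Q
    small = ≤÷⇒*≤ (*-pos (0<size h) K>0) ε≤

module CyclicOrder where

  open import Data.Fin using (Fin)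
  open import Data.Fin.Patterns using (0F; 1F; 2F)
  open import Data.Sum using (_⊎_; inj₁; inj₂)
  open import Relation.Binary.PropositionalEquality using (_≡_; _≢_; refl)
  open import Relation.Nullary using (contradiction)

  infix 10 _⁺ _⁻

  _⁺ : Fin 3 → Fin 3
  0F ⁺ = 1F
  1F ⁺ = 2F
  2F ⁺ = 0F

  _⁻ : Fin 3 → Fin 3
  0F ⁻ = 2F
  1F ⁻ = 0F
  2F ⁻ = 1F

  ⁺⁺≡⁻ : ∀ p → p ⁺ ⁺ ≡ p ⁻
  ⁺⁺≡⁻ 0F = refl
  ⁺⁺≡⁻ 1F = refl
  ⁺⁺≡⁻ 2F = refl

  ⁻⁺≡id : ∀ p → p ⁻ ⁺ ≡ p
  ⁻⁺≡id 0F = refl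
  ⁻⁺≡id 1F = refl
  ⁻⁺≡id 2F = refl

  ⁺≢id : ∀ p → p ⁺ ≢ p
  ⁺≢id 0F ()
  ⁺≢id 1F ()
  ⁺≢id 2F ()

  ⁻≢id : ∀ p → p ⁻ ≢ p
  ⁻≢id 0F ()
  ⁻≢id 1F ()
  ⁻≢id 2F ()

  ⁺≢⁻ : ∀ p → p ⁺ ≢ p ⁻
  ⁺≢⁻ 0F ()
  ⁺≢⁻ 1F ()
  ⁺≢⁻ 2F ()

  neighbours : ∀ p a → a ≢ p → a ≡ p ⁺ ⊎ a ≡ p ⁻
  neighbours 0F 0F a≢p = contradiction refl a≢p
  neighbours 0F 1F _   = inj₁ refl
  neighbours 0F 2F _   = inj₂ refl
  neighbours 1F 0F _   = inj₂ refl
  neighbours 1F 1F a≢p = contradiction refl a≢p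
  neighbours 1F 2F _   = inj₁ refl
  neighbours 2F 0F _   = inj₁ refl
  neighbours 2F 1F _   = inj₂ refl
  neighbours 2F 2F a≢p = contradiction refl a≢p

module Wedges where

  open RationalSigns
  open Plane
  open Separation
  open import Defs using (Point; OnSeg)
  open import Data.Rational using (ℚ; 0ℚ; 1ℚ; _+_; _*_; _-_; -_; _<_; _≤_)
  open import Data.Rational.Properties
  open import Data.Rational.Solver
  open +-*-Solver using (solve; _:+_; _:*_; _:-_; :-_; _:=_; con)
  open import Data.Product using (_×_; _,_; Σ-syntax)
  open import Data.Sum using (_⊎_; inj₁; inj₂)
  open import Data.Empty using (⊥)
  open import Relation.Binary.PropositionalEquality
  open import Relation.Nullary using (yes; no; contradiction)

  -- Positive when t lies strictly to the left of the line through C in direction v.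
  side : Point → Point → Point → ℚ
  side C v t = cross v (t -ᵥ C)

  Ray : Point → Point → Point → Set
  Ray C X t = Σ[ l ∈ ℚ ] 0ℚ < l × t ≡ C ⊕ l · (X -ᵥ C)

  cross-self : ∀ v → cross v v ≡ 0ℚ
  cross-self (x , y) = solve 2 (λ x y → x :* y :- y :* x := con 0ℚ) refl x y

  cross-antisym : ∀ u v → cross u v ≡ - cross v u
  cross-antisym (ux , uy) (vx , vy) = solve 4 (λ ux uy vx vy →
    ux :* vy :- uy :* vx := :- (vx :* uy :- vy :* ux)) refl ux uy vx vy

  cross-negˡ : ∀ u v → cross (-ᵥ u) v ≡ - cross u v
  cross-negˡ (ux , uy) (vx , vy) = solve 4 (λ ux uy vx vy →
    (:- ux) :* vy :- (:- uy) :* vx := :- (ux :* vy :- uy :* vx)) refl ux uy vx vy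

  cross-negʳ : ∀ u v → cross u (-ᵥ v) ≡ - cross u v
  cross-negʳ (ux , uy) (vx , vy) = solve 4 (λ ux uy vx vy →
    ux :* (:- vy) :- uy :* (:- vx) := :- (ux :* vy :- uy :* vx)) refl ux uy vx vy

  cross-+ˡ : ∀ u v w → cross (u +ᵥ v) w ≡ cross u w + cross v w
  cross-+ˡ (ux , uy) (vx , vy) (wx , wy) = solve 6 (λ ux uy vx vy wx wy →
    (ux :+ vx) :* wy :- (uy :+ vy) :* wx := (ux :* wy :- uy :* wx) :+ (vx :* wy :- vy :* wx)) refl ux uy vx vy wx wy

  cross-neg-neg : ∀ u v → cross (-ᵥ u) (-ᵥ v) ≡ cross u v
  cross-neg-neg u v = trans (cross-negˡ u (-ᵥ v)) (trans (cong -_ (cross-negʳ u v)) (neg-involutive (cross u v)))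

  side-centre : ∀ C v → side C v C ≡ 0ℚ
  side-centre (cx , cy) (vx , vy) = solve 4 (λ cx cy vx vy → vx :* (cy :- cy) :- vy :* (cx :- cx) := con 0ℚ) refl cx cy vx vy

  side-ray : ∀ {C X t} v → Ray C X t → Σ[ l ∈ ℚ ] 0ℚ < l × side C v t ≡ l * cross v (X -ᵥ C)
  side-ray {(cx , cy)} {(xx , xy)} (vx , vy) (l , l>0 , refl) = l , l>0 , solve 7 (λ cx cy xx xy l vx vy →
     vx :* ((cy :+ l :* (xy :- cy)) :- cy) :- vy :* ((cx :+ l :* (xx :- cx)) :- cx)
     := l :* (vx :* (xy :- cy) :- vy :* (xx :- cx))) refl cx cy xx xy l vx vy

  ray-side-nonPos : ∀ {C X t} v → Ray C X t → cross v (X -ᵥ C) ≤ 0ℚ → 0ℚ < side C v t → ⊥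
  ray-side-nonPos {C} {X} {t} v ray v×u≤0 side>0 with side-ray {C} {X} {t} v ray
  ... | l , l>0 , side≡ = <⇒≱ (subst (0ℚ <_) side≡ side>0) (*-nonNeg-nonPos (<⇒≤ l>0) v×u≤0)

  side-opposite : ∀ {C t} v → 0ℚ < side C v t → 0ℚ < side C (-ᵥ v) t → ⊥
  side-opposite {C} {t} v side>0 -side>0 = <-asym side>0 (neg-cancel-< (subst (0ℚ <_) (cross-negˡ v (t -ᵥ C)) -side>0))

  record FromApex (C d X : Point) (ε : ℚ) (t : Point) : Set where
    constructor fromApex
    field
      s       : ℚ
      0≤s     : 0ℚ ≤ s
      s≤1     : s ≤ 1ℚ
      side≡   : ∀ v → side C v t ≡ (1ℚ - s) * (ε * cross v d) + s * cross v (X -ᵥ C)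
      at-apex : s ≡ 0ℚ → t ≡ C ⊕ ε · d
      at-X    : s ≡ 1ℚ → t ≡ X

  segment-fromApex : ∀ C d X ε {t} → OnSeg (C ⊕ ε · d) X t → FromApex C d X ε t
  segment-fromApex C@(cx , cy) d@(dx , dy) X@(xx , xy) ε (s , 0≤s , s≤1 , refl) = fromApex s 0≤s s≤1
    (λ { (vx , vy) → solve 10 (λ cx cy dx dy xx xy e s vx vy →
        vx :* ((cy :+ e :* dy) :+ s :* (xy :- (cy :+ e :* dy)) :- cy) :- vy :* ((cx :+ e :* dx) :+ s :* (xx :- (cx :+ e :* dx)) :- cx)
        := (con 1ℚ :- s) :* (e :* (vx :* dy :- vy :* dx)) :+ s :* (vx :* (xy :- cy) :- vy :* (xx :- cx)))
        refl cx cy dx dy xx xy ε s vx vy })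
    (λ { refl → ⊕-zero-scalar (C ⊕ ε · d) (X -ᵥ (C ⊕ ε · d)) })
    (λ { refl → ⊕-one (C ⊕ ε · d) X })

  side-direction : ∀ {C d X ε t} (seg : FromApex C d X ε t) → side C d t ≡ FromApex.s seg * cross d (X -ᵥ C)
  side-direction {C} {d} {X} {ε} {t} (fromApex s _ _ side≡ _ _) = begin
    side C d t                                 ≡⟨ side≡ d ⟩
    (1ℚ - s) * (ε * cross d d) + s * w         ≡⟨ cong (λ z → (1ℚ - s) * (ε * z) + s * w) (cross-self d) ⟩
    (1ℚ - s) * (ε * 0ℚ) + s * w                ≡⟨ solve 3 (λ s e w → (con 1ℚ :- s) :* (e :* con 0ℚ) :+ s :* w := s :* w)
                                                     refl s ε w ⟩
    s * w                                      ∎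
    where
    open ≡-Reasoning
    w = cross d (X -ᵥ C)

  side-pos-fromApex : ∀ {C d X ε t} v → FromApex C d X ε t → 0ℚ < ε →
    0ℚ < cross v d → 0ℚ ≤ cross v (X -ᵥ C) → t ≡ X ⊎ 0ℚ < side C v t
  side-pos-fromApex {C} {d} {X} {ε} v (fromApex s 0≤s s≤1 side≡ _ at-X) ε>0 v×d>0 v×u≥0 with s ≟ 1ℚ
  ... | yes s≡1 = inj₁ (at-X s≡1)
  ... | no  s≢1 = inj₂ (subst (0ℚ <_) (sym (side≡ v))
                     (+-pos (*-pos (p<q⇒0<q-p (≤∧≢⇒< s≤1 s≢1)) (*-pos ε>0 v×d>0)) (*-nonNeg 0≤s v×u≥0)))

  fromApex-meet : ∀ {C d Xa Xb ε t} → FromApex C d Xa ε t → FromApex C d Xb ε t →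
    0ℚ < cross d (Xa -ᵥ C) → cross d (Xb -ᵥ C) < 0ℚ → t ≡ C ⊕ ε · d
  fromApex-meet {C} {d} {Xa} {Xb} segA segB d×ua>0 d×ub<0 with sign (FromApex.s segA)
  ... | <0 s<0 = contradiction (FromApex.0≤s segA) (<⇒≱ s<0)
  ... | ≡0 s≡0 = FromApex.at-apex segA s≡0
  ... | >0 s>0 = contradiction
    (subst (_≤ 0ℚ) (sym (side-direction segB)) (*-nonNeg-nonPos (FromApex.0≤s segB) (<⇒≤ d×ub<0)))
    (<⇒≱ (subst (0ℚ <_) (sym (side-direction segA)) (*-pos s>0 d×ua>0)))

  -- The open wedge swept counterclockwise from direction u to direction w at C.
  Wedge : Point → Point → Point → Point → Set
  Wedge C u w t = 0ℚ < side C u t × 0ℚ < side C (-ᵥ w) t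

  cross-+-self : ∀ u w → cross u (u +ᵥ w) ≡ cross u w
  cross-+-self (ux , uy) (wx , wy) = solve 4 (λ ux uy wx wy →
    ux :* (uy :+ wy) :- uy :* (ux :+ wx) := ux :* wy :- uy :* wx) refl ux uy wx wy

  cross-neg-+ : ∀ u w → cross (-ᵥ w) (u +ᵥ w) ≡ cross u w
  cross-neg-+ (ux , uy) (wx , wy) = solve 4 (λ ux uy wx wy →
    (:- wx) :* (uy :+ wy) :- (:- wy) :* (ux :+ wx) := ux :* wy :- uy :* wx) refl ux uy wx wy

  cross-neg-swap : ∀ u w → cross (-ᵥ w) u ≡ cross u w
  cross-neg-swap (ux , uy) (wx , wy) = solve 4 (λ ux uy wx wy →
    (:- wx) :* uy :- (:- wy) :* ux := ux :* wy :- uy :* wx) refl ux uy wx wy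

  cross-neg-self : ∀ w → cross (-ᵥ w) w ≡ 0ℚ
  cross-neg-self w = trans (cross-negˡ w w) (cong -_ (cross-self w))

  private
    both : ∀ {A P Q : Set} → A ⊎ P → A ⊎ Q → A ⊎ (P × Q)
    both (inj₁ a) _        = inj₁ a
    both (inj₂ _) (inj₁ a) = inj₁ a
    both (inj₂ p) (inj₂ q) = inj₂ (p , q)

  module ConvexWedge {C Xa Xb : Point} (ε : ℚ) (ε>0 : 0ℚ < ε) (ua×ub>0 : 0ℚ < cross (Xa -ᵥ C) (Xb -ᵥ C)) where

    private
      ua = Xa -ᵥ C
      ub = Xb -ᵥ C
      apex = C ⊕ ε · (ua +ᵥ ub)

    first⊆wedge : ∀ {t} → OnSeg apex Xa t → t ≡ Xa ⊎ Wedge C ua ub t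
    first⊆wedge {t} t∈ = both
      (side-pos-fromApex ua seg ε>0 (subst (0ℚ <_) (sym (cross-+-self ua ub)) ua×ub>0) (≤-reflexive (sym (cross-self ua))))
      (side-pos-fromApex (-ᵥ ub) seg ε>0 (subst (0ℚ <_) (sym (cross-neg-+ ua ub)) ua×ub>0)
                         (<⇒≤ (subst (0ℚ <_) (sym (cross-neg-swap ua ub)) ua×ub>0)))
      where
      seg : FromApex C (ua +ᵥ ub) Xa ε t
      seg = segment-fromApex C (ua +ᵥ ub) Xa ε t∈

    second⊆wedge : ∀ {t} → OnSeg apex Xb t → t ≡ Xb ⊎ Wedge C ua ub t
    second⊆wedge {t} t∈ = both
      (side-pos-fromApex ua seg ε>0 (subst (0ℚ <_) (sym (cross-+-self ua ub)) ua×ub>0) (<⇒≤ ua×ub>0))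
      (side-pos-fromApex (-ᵥ ub) seg ε>0 (subst (0ℚ <_) (sym (cross-neg-+ ua ub)) ua×ub>0)
                         (≤-reflexive (sym (cross-neg-self ub))))
      where
      seg : FromApex C (ua +ᵥ ub) Xb ε t
      seg = segment-fromApex C (ua +ᵥ ub) Xb ε t∈

    meet-at-apex : ∀ {t} → OnSeg apex Xa t → OnSeg apex Xb t → t ≡ apex
    meet-at-apex t∈a t∈b = fromApex-meet (segment-fromApex C (ua +ᵥ ub) Xb ε t∈b) (segment-fromApex C (ua +ᵥ ub) Xa ε t∈a)
      (subst (0ℚ <_) (sym (trans (cross-+ˡ ua ub ub) (trans (cong (cross ua ub +_) (cross-self ub)) (+-identityʳ _)))) ua×ub>0)
      (subst (_< 0ℚ) (sym (trans (cross-+ˡ ua ub ua) (trans (cong (_+ cross ub ua) (cross-self ua))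
                                                          (trans (+-identityˡ _) (cross-antisym ub ua)))))
             (neg-antimono-< ua×ub>0))

  -- Cramer's rule for the sides of t with respect to three directions.
  cramer : ∀ C a b c t → cross a b * side C c t ≡ side C (-ᵥ b) t * cross c a + side C a t * cross c b
  cramer (cx , cy) (ax , ay) (bx , by) (ex , ey) (tx , ty) = solve 10 (λ cx cy ax ay bx by ex ey tx ty →
    (ax :* by :- ay :* bx) :* (ex :* (ty :- cy) :- ey :* (tx :- cx)) :=
    ((:- bx) :* (ty :- cy) :- (:- by) :* (tx :- cx)) :* (ex :* ay :- ey :* ax)
    :+ (ax :* (ty :- cy) :- ay :* (tx :- cx)) :* (ex :* by :- ey :* bx)) refl cx cy ax ay bx by ex ey tx ty

  dot-ray : ∀ {C X t} v → Ray C X t → Σ[ l ∈ ℚ ] 0ℚ < l × dot v (t -ᵥ C) ≡ l * dot v (X -ᵥ C)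
  dot-ray {(cx , cy)} {(xx , xy)} (vx , vy) (l , l>0 , refl) = l , l>0 , solve 7 (λ cx cy xx xy l vx vy →
     vx :* ((cx :+ l :* (xx :- cx)) :- cx) :+ vy :* ((cy :+ l :* (xy :- cy)) :- cy)
     := l :* (vx :* (xx :- cx) :+ vy :* (xy :- cy))) refl cx cy xx xy l vx vy

  onSeg⇒ray : ∀ {C X t} → OnSeg C X t → t ≡ C ⊎ Ray C X t
  onSeg⇒ray {C} {X} (s , 0≤s , _ , refl) with sign s
  ... | <0 s<0 = contradiction 0≤s (<⇒≱ s<0)
  ... | ≡0 refl = inj₁ (⊕-zero-scalar C (X -ᵥ C))
  ... | >0 s>0 = inj₂ (s , s>0 , refl)

  ray-end : ∀ C X → Ray C X X
  ray-end C X = 1ℚ , 0<1 , sym (⊕-one C X)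

  rays-disjoint : ∀ {C Xa Xb t} → Xa ≢ C → NotSameDirection (Xa -ᵥ C) (Xb -ᵥ C) → Ray C Xa t → Ray C Xb t → ⊥
  rays-disjoint {C} {Xa} {Xb} {t} _ (inj₁ ua×ub≢0) ra rb
    with side-ray {C} {Xa} {t} (Xa -ᵥ C) ra | side-ray {C} {Xb} {t} (Xa -ᵥ C) rb
  ... | l , _ , eqa | m , m>0 , eqb = ua×ub≢0 (*-cancelˡ-≡0 (λ m≡0 → <-irrefl (sym m≡0) m>0)
    (trans (sym eqb) (trans eqa (trans (cong (l *_) (cross-self (Xa -ᵥ C))) (*-zeroʳ l)))))
  rays-disjoint {C} {Xa} {Xb} {t} Xa≢C (inj₂ ua·ub<0) ra rb
    with dot-ray {C} {Xa} {t} (Xa -ᵥ C) ra | dot-ray {C} {Xb} {t} (Xa -ᵥ C) rb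
  ... | l , l>0 , eqa | m , m>0 , eqb = <-asym
    (subst (0ℚ <_) (trans (sym eqa) eqb) (*-pos l>0 (0<sqLen C Xa (λ C≡Xa → Xa≢C (sym C≡Xa)))))
    (*-pos-neg m>0 ua·ub<0)

module SectorLayouts where

  open RationalSigns
  open Plane
  open Separation
  open Wedges
  open CyclicOrder
  open import Defs using (Point; OnSeg)
  open import Data.Rational using (ℚ; 0ℚ; _+_; _*_; _-_; -_; _<_; _≤_)
  open import Data.Rational.Properties
  open import Data.Rational.Solver
  open +-*-Solver using (solve; _:+_; _:*_; _:-_; :-_; _:=_; con)
  open import Data.Fin using (Fin; zero; suc; opposite)
  open import Data.Fin.Patterns using (0F; 1F; 2F)
  open import Data.Fin.Properties using (opposite-involutive) renaming (_≟_ to _≟ᶠ_)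
  open import Data.Fin.Permutation using (Permutation′; _⟨$⟩ʳ_; _⟨$⟩ˡ_; inverseˡ; inverseʳ; flip; transpose; _∘ₚ_)
  open import Data.Product using (_×_; _,_)
  open import Data.Sum using (_⊎_; inj₁; inj₂; map₂)
  open import Data.Empty using (⊥; ⊥-elim)
  open import Data.Unit using (⊤)
  open import Function using (_∘_)
  open import Relation.Binary.PropositionalEquality
  open import Relation.Nullary using (yes; no; contradiction)

  record SectorLayout (C : Point) (X P : Fin 3 → Point) : Set₁ where
    field
      Sector           : Fin 3 → Point → Set
      segment⊆sector   : ∀ p a → a ≢ p → ∀ {t} → OnSeg (P p) (X a) t → t ≡ X a ⊎ Sector p t
      sectors-disjoint : ∀ p q → p ≢ q → ∀ {t} → Sector p t → Sector q t → ⊥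
      sector∩ray       : ∀ p a {t} → Sector p t → Ray C (X a) t → ⊥
      centre∉sector    : ∀ p → Sector p C → ⊥
      meet-at-apex     : ∀ p a b → a ≢ p → b ≢ p → a ≢ b → ∀ {t} →
                         OnSeg (P p) (X a) t → OnSeg (P p) (X b) t → t ≡ P p

  record CyclicLayout (C : Point) (X P : Fin 3 → Point) : Set₁ where
    field
      Sector          : Fin 3 → Point → Set
      next⊆sector     : ∀ p {t} → OnSeg (P p) (X (p ⁺)) t → t ≡ X (p ⁺) ⊎ Sector p t
      prev⊆sector     : ∀ p {t} → OnSeg (P p) (X (p ⁻)) t → t ≡ X (p ⁻) ⊎ Sector p t
      sector-disjoint : ∀ p {t} → Sector p t → Sector (p ⁺) t → ⊥
      sector∩ray      : ∀ p a {t} → Sector p t → Ray C (X a) t → ⊥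
      centre∉sector   : ∀ p → Sector p C → ⊥
      meet-at-apex    : ∀ p {t} → OnSeg (P p) (X (p ⁺)) t → OnSeg (P p) (X (p ⁻)) t → t ≡ P p

  cyclic⇒sectorLayout : ∀ {C X P} → CyclicLayout C X P → SectorLayout C X P
  cyclic⇒sectorLayout {C} {X} {P} L = record
    { Sector           = Sector
    ; segment⊆sector   = segment⊆sector
    ; sectors-disjoint = sectors-disjoint
    ; sector∩ray       = sector∩ray
    ; centre∉sector    = centre∉sector
    ; meet-at-apex     = apex
    }
    where
    open CyclicLayout L
    segment⊆sector : ∀ p a → a ≢ p → ∀ {t} → OnSeg (P p) (X a) t → t ≡ X a ⊎ Sector p t
    segment⊆sector p a a≢p with neighbours p a a≢p
    ... | inj₁ refl = next⊆sector p
    ... | inj₂ refl = prev⊆sector p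
    sectors-disjoint : ∀ p q → p ≢ q → ∀ {t} → Sector p t → Sector q t → ⊥
    sectors-disjoint p q p≢q {t} with neighbours p q (λ q≡p → p≢q (sym q≡p))
    ... | inj₁ refl = sector-disjoint p
    ... | inj₂ refl = λ sp sq → sector-disjoint (p ⁻) sq (subst (λ r → Sector r t) (sym (⁻⁺≡id p)) sp)
    apex : ∀ p a b → a ≢ p → b ≢ p → a ≢ b → ∀ {t} → OnSeg (P p) (X a) t → OnSeg (P p) (X b) t → t ≡ P p
    apex p a b a≢p b≢p a≢b with neighbours p a a≢p | neighbours p b b≢p
    ... | inj₁ refl | inj₁ refl = contradiction refl a≢b
    ... | inj₁ refl | inj₂ refl = meet-at-apex p
    ... | inj₂ refl | inj₁ refl = λ t∈a t∈b → meet-at-apex p t∈b t∈a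
    ... | inj₂ refl | inj₂ refl = contradiction refl a≢b

  relabel : ∀ {C X Y P Q} (π : Permutation′ 3) → (∀ a → X a ≡ Y (π ⟨$⟩ʳ a)) → (∀ p → P p ≡ Q (π ⟨$⟩ʳ p)) →
    SectorLayout C Y Q → SectorLayout C X P
  relabel {C} {X} {Y} {P} {Q} π X≡ P≡ L = record
    { Sector           = λ p → Sector (τ p)
    ; segment⊆sector   = λ p a a≢p {t} t∈ →
        subst (λ z → t ≡ z ⊎ Sector (τ p) t) (sym (X≡ a)) (segment⊆sector (τ p) (τ a) (a≢p ∘ τ-injective) (move p a t∈))
    ; sectors-disjoint = λ p q p≢q → sectors-disjoint (τ p) (τ q) (p≢q ∘ τ-injective)
    ; sector∩ray       = λ p a {t} s r → sector∩ray (τ p) (τ a) s (subst (λ z → Ray C z t) (X≡ a) r)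
    ; centre∉sector    = λ p → centre∉sector (τ p)
    ; meet-at-apex     = λ p a b a≢p b≢p a≢b t∈a t∈b →
        trans (meet-at-apex (τ p) (τ a) (τ b) (a≢p ∘ τ-injective) (b≢p ∘ τ-injective) (a≢b ∘ τ-injective)
                            (move p a t∈a) (move p b t∈b))
              (sym (P≡ p))
    }
    where
    open SectorLayout L
    τ : Fin 3 → Fin 3
    τ = π ⟨$⟩ʳ_
    τ-injective : ∀ {a b} → τ a ≡ τ b → a ≡ b
    τ-injective {a} {b} τa≡τb = trans (sym (inverseˡ π)) (trans (cong (π ⟨$⟩ˡ_) τa≡τb) (inverseˡ π))
    move : ∀ p a {t} → OnSeg (P p) (X a) t → OnSeg (Q (τ p)) (Y (τ a)) t
    move p a {t} t∈ = subst₂ (λ A B → OnSeg A B t) (P≡ p) (X≡ a) t∈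

  record Placement (C : Point) (X : Fin 3 → Point) : Set₁ where
    constructor placement
    field
      direction : Fin 3 → Point
      layout    : ∀ ε → 0ℚ < ε → SectorLayout C X (λ p → C ⊕ ε · direction p)

  private
    cross-swap-neg : ∀ u w → 0ℚ < cross u w → cross w u < 0ℚ
    cross-swap-neg u w u×w>0 = subst (_< 0ℚ) (sym (cross-antisym w u)) (neg-antimono-< u×w>0)

    cross-swap-nonPos : ∀ u w → 0ℚ ≤ cross u w → cross w u ≤ 0ℚ
    cross-swap-nonPos u w u×w≥0 = subst (_≤ 0ℚ) (sym (cross-antisym w u)) (neg-antimono-≤ u×w≥0)

    cross-negˡ-neg : ∀ u w → 0ℚ < cross u w → cross (-ᵥ u) w < 0ℚ
    cross-negˡ-neg u w u×w>0 = subst (_< 0ℚ) (sym (cross-negˡ u w)) (neg-antimono-< u×w>0)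

    cross-negˡ-nonPos : ∀ u w → 0ℚ ≤ cross u w → cross (-ᵥ u) w ≤ 0ℚ
    cross-negˡ-nonPos u w u×w≥0 = subst (_≤ 0ℚ) (sym (cross-negˡ u w)) (neg-antimono-≤ u×w≥0)

    cross-swap-pos : ∀ u w → cross u w < 0ℚ → 0ℚ < cross w u
    cross-swap-pos u w u×w<0 = subst (0ℚ <_) (sym (cross-antisym w u)) (neg-antimono-< u×w<0)

    cross-swap-nonNeg : ∀ u w → cross u w ≤ 0ℚ → 0ℚ ≤ cross w u
    cross-swap-nonNeg u w u×w≤0 = subst (0ℚ ≤_) (sym (cross-antisym w u)) (neg-antimono-≤ u×w≤0)

    centre-side : ∀ {C} v → 0ℚ < side C v C → ⊥
    centre-side {C} v side>0 = <-irrefl (sym (side-centre C v)) side>0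

  module AllConvex (C : Point) (X : Fin 3 → Point) (ccw : ∀ p → 0ℚ < cross (X p -ᵥ C) (X (p ⁺) -ᵥ C)) where

    private
      u : Fin 3 → Point
      u a = X a -ᵥ C

      ccw′ : ∀ p → 0ℚ < cross (u (p ⁺)) (u (p ⁻))
      ccw′ p = subst (λ a → 0ℚ < cross (u (p ⁺)) (u a)) (⁺⁺≡⁻ p) (ccw (p ⁺))

    direction : Fin 3 → Point
    direction p = u (p ⁺) +ᵥ u (p ⁻)

    layout : ∀ ε → 0ℚ < ε → CyclicLayout C X (λ p → C ⊕ ε · direction p)
    layout ε ε>0 = record
      { Sector          = λ p → Wedge C (u (p ⁺)) (u (p ⁻))
      ; next⊆sector     = λ p → ConvexWedge.first⊆wedge {C} {X (p ⁺)} {X (p ⁻)} ε ε>0 (ccw′ p)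
      ; prev⊆sector     = λ p → ConvexWedge.second⊆wedge {C} {X (p ⁺)} {X (p ⁻)} ε ε>0 (ccw′ p)
      ; sector-disjoint = λ p {t} (_ , right) (left , _) →
                            side-opposite {C} {t} (u (p ⁻)) (subst (λ a → 0ℚ < side C (u a) t) (⁺⁺≡⁻ p) left) right
      ; sector∩ray      = ray
      ; centre∉sector   = λ p (left , _) → centre-side {C} (u (p ⁺)) left
      ; meet-at-apex    = λ p → ConvexWedge.meet-at-apex {C} {X (p ⁺)} {X (p ⁻)} ε ε>0 (ccw′ p)
      }
      where
      ray : ∀ p a {t} → Wedge C (u (p ⁺)) (u (p ⁻)) t → Ray C (X a) t → ⊥
      ray p a {t} (left , right) r with a ≟ᶠ p
      ... | yes refl = ray-side-nonPos {C} {X a} {t} (u (p ⁺)) r (<⇒≤ (cross-swap-neg (u p) (u (p ⁺)) (ccw p))) left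
      ... | no a≢p with neighbours p a a≢p
      ...   | inj₁ refl = ray-side-nonPos {C} {X a} {t} (u (p ⁺)) r (≤-reflexive (cross-self (u (p ⁺)))) left
      ...   | inj₂ refl = ray-side-nonPos {C} {X a} {t} (-ᵥ u (p ⁻)) r (≤-reflexive (cross-neg-self (u (p ⁻)))) right

  module OneReflex (C : Point) (X : Fin 3 → Point)
    (u₀×u₂>0 : 0ℚ < cross (X 0F -ᵥ C) (X 2F -ᵥ C))
    (u₂×u₁>0 : 0ℚ < cross (X 2F -ᵥ C) (X 1F -ᵥ C))
    (u₀×u₁≥0 : 0ℚ ≤ cross (X 0F -ᵥ C) (X 1F -ᵥ C)) where

    private
      u₀ u₁ u₂ : Point
      u₀ = X 0F -ᵥ C
      u₁ = X 1F -ᵥ C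
      u₂ = X 2F -ᵥ C

    -- The arms turn counterclockwise in the order 0F, 2F, 1F by at most π in total, so the sector
    -- omitting X 2F is reflex; its apex is pushed away from X 2F.
    direction : Fin 3 → Point
    direction 0F = u₂ +ᵥ u₁
    direction 1F = u₀ +ᵥ u₂
    direction 2F = -ᵥ u₂

    Sector : Fin 3 → Point → Set
    Sector 0F = Wedge C u₂ u₁
    Sector 1F = Wedge C u₀ u₂
    Sector 2F t = 0ℚ < side C (-ᵥ u₀) t ⊎ 0ℚ < side C u₁ t

    private
      reflex-meets-wedge₁ : ∀ {t} → 0ℚ < side C u₁ t → Wedge C u₀ u₂ t → ⊥
      reflex-meets-wedge₁ {t} right (a , b) = <-asym
        (subst (0ℚ <_) (cramer C u₀ u₂ u₁ t) (*-pos u₀×u₂>0 right))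
        (+-nonPos-neg (*-nonNeg-nonPos (<⇒≤ b) (cross-swap-nonPos u₀ u₁ u₀×u₁≥0))
                      (*-pos-neg a (cross-swap-neg u₂ u₁ u₂×u₁>0)))

      reflex-meets-wedge₀ : ∀ {t} → 0ℚ < side C (-ᵥ u₀) t → Wedge C u₂ u₁ t → ⊥
      reflex-meets-wedge₀ {t} left (a , b) = <-asym
        (subst (0ℚ <_) (cramer C u₂ u₁ (-ᵥ u₀) t) (*-pos u₂×u₁>0 left))
        (+-neg-nonPos (*-pos-neg b (cross-negˡ-neg u₀ u₂ u₀×u₂>0))
                      (*-nonNeg-nonPos (<⇒≤ a) (cross-negˡ-nonPos u₀ u₁ u₀×u₁≥0)))

      ray : ∀ p a {t} → Sector p t → Ray C (X a) t → ⊥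
      ray 0F 0F {t} (a , _) r = ray-side-nonPos {C} {X 0F} {t} u₂ r (<⇒≤ (cross-swap-neg u₀ u₂ u₀×u₂>0)) a
      ray 0F 1F {t} (_ , b) r = ray-side-nonPos {C} {X 1F} {t} (-ᵥ u₁) r (≤-reflexive (cross-neg-self u₁)) b
      ray 0F 2F {t} (a , _) r = ray-side-nonPos {C} {X 2F} {t} u₂ r (≤-reflexive (cross-self u₂)) a
      ray 1F 0F {t} (a , _) r = ray-side-nonPos {C} {X 0F} {t} u₀ r (≤-reflexive (cross-self u₀)) a
      ray 1F 1F {t} (_ , b) r = ray-side-nonPos {C} {X 1F} {t} (-ᵥ u₂) r (<⇒≤ (cross-negˡ-neg u₂ u₁ u₂×u₁>0)) b
      ray 1F 2F {t} (_ , b) r = ray-side-nonPos {C} {X 2F} {t} (-ᵥ u₂) r (≤-reflexive (cross-neg-self u₂)) b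
      ray 2F 0F {t} (inj₁ l) r = ray-side-nonPos {C} {X 0F} {t} (-ᵥ u₀) r (≤-reflexive (cross-neg-self u₀)) l
      ray 2F 1F {t} (inj₁ l) r = ray-side-nonPos {C} {X 1F} {t} (-ᵥ u₀) r (cross-negˡ-nonPos u₀ u₁ u₀×u₁≥0) l
      ray 2F 2F {t} (inj₁ l) r = ray-side-nonPos {C} {X 2F} {t} (-ᵥ u₀) r (<⇒≤ (cross-negˡ-neg u₀ u₂ u₀×u₂>0)) l
      ray 2F 0F {t} (inj₂ q) r = ray-side-nonPos {C} {X 0F} {t} u₁ r (cross-swap-nonPos u₀ u₁ u₀×u₁≥0) q
      ray 2F 1F {t} (inj₂ q) r = ray-side-nonPos {C} {X 1F} {t} u₁ r (≤-reflexive (cross-self u₁)) q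
      ray 2F 2F {t} (inj₂ q) r = ray-side-nonPos {C} {X 2F} {t} u₁ r (<⇒≤ (cross-swap-neg u₂ u₁ u₂×u₁>0)) q

      centre : ∀ p → Sector p C → ⊥
      centre 0F (a , _)  = centre-side {C} u₂ a
      centre 1F (a , _)  = centre-side {C} u₀ a
      centre 2F (inj₁ l) = centre-side {C} (-ᵥ u₀) l
      centre 2F (inj₂ q) = centre-side {C} u₁ q

      disjoint : ∀ p {t} → Sector p t → Sector (p ⁺) t → ⊥
      disjoint 0F {t} (a , _) (_ , d)  = side-opposite {C} {t} u₂ a d
      disjoint 1F {t} (a , _) (inj₁ l) = side-opposite {C} {t} u₀ a l
      disjoint 1F {t} w       (inj₂ r) = reflex-meets-wedge₁ {t} r w
      disjoint 2F {t} (inj₁ l) w       = reflex-meets-wedge₀ {t} l w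
      disjoint 2F {t} (inj₂ r) (_ , b) = side-opposite {C} {t} u₁ r b

    layout : ∀ ε → 0ℚ < ε → CyclicLayout C X (λ p → C ⊕ ε · direction p)
    layout ε ε>0 = record
      { Sector          = Sector
      ; next⊆sector     = next
      ; prev⊆sector     = prev
      ; sector-disjoint = disjoint
      ; sector∩ray      = ray
      ; centre∉sector   = centre
      ; meet-at-apex    = apex
      }
      where
      module W₀ = ConvexWedge {C} {X 2F} {X 1F} ε ε>0 u₂×u₁>0
      module W₁ = ConvexWedge {C} {X 0F} {X 2F} ε ε>0 u₀×u₂>0
      P₂ : Point
      P₂ = C ⊕ ε · (-ᵥ u₂)

      reflex₀ : ∀ {t} → OnSeg P₂ (X 0F) t → t ≡ X 0F ⊎ Sector 2F t
      reflex₀ {t} t∈ = map₂ (inj₁ {B = 0ℚ < side C u₁ t})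
        (side-pos-fromApex (-ᵥ u₀) (segment-fromApex C (-ᵥ u₂) (X 0F) ε t∈) ε>0
          (subst (0ℚ <_) (sym (cross-neg-neg u₀ u₂)) u₀×u₂>0) (≤-reflexive (sym (cross-neg-self u₀))))

      reflex₁ : ∀ {t} → OnSeg P₂ (X 1F) t → t ≡ X 1F ⊎ Sector 2F t
      reflex₁ {t} t∈ = map₂ (inj₂ {A = 0ℚ < side C (-ᵥ u₀) t})
        (side-pos-fromApex u₁ (segment-fromApex C (-ᵥ u₂) (X 1F) ε t∈) ε>0
          (subst (0ℚ <_) (sym u₁×-u₂≡u₂×u₁) u₂×u₁>0) (≤-reflexive (sym (cross-self u₁))))
        where
        u₁×-u₂≡u₂×u₁ : cross u₁ (-ᵥ u₂) ≡ cross u₂ u₁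
        u₁×-u₂≡u₂×u₁ = trans (cross-negʳ u₁ u₂) (trans (cong -_ (cross-antisym u₁ u₂)) (neg-involutive (cross u₂ u₁)))

      next : ∀ p {t} → OnSeg (C ⊕ ε · direction p) (X (p ⁺)) t → t ≡ X (p ⁺) ⊎ Sector p t
      next 0F = W₀.second⊆wedge
      next 1F = W₁.second⊆wedge
      next 2F = reflex₀

      prev : ∀ p {t} → OnSeg (C ⊕ ε · direction p) (X (p ⁻)) t → t ≡ X (p ⁻) ⊎ Sector p t
      prev 0F = W₀.first⊆wedge
      prev 1F = W₁.first⊆wedge
      prev 2F = reflex₁

      apex : ∀ p {t} → OnSeg (C ⊕ ε · direction p) (X (p ⁺)) t → OnSeg (C ⊕ ε · direction p) (X (p ⁻)) t →
             t ≡ C ⊕ ε · direction p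
      apex 0F t∈₁ t∈₂ = W₀.meet-at-apex t∈₂ t∈₁
      apex 1F t∈₂ t∈₀ = W₁.meet-at-apex t∈₀ t∈₂
      apex 2F t∈₀ t∈₁ = fromApex-meet
        (segment-fromApex C (-ᵥ u₂) (X 0F) ε t∈₀) (segment-fromApex C (-ᵥ u₂) (X 1F) ε t∈₁)
        (subst (0ℚ <_) (sym (cross-neg-swap u₀ u₂)) u₀×u₂>0) (cross-negˡ-neg u₂ u₁ u₂×u₁>0)

  allConvex-placement : ∀ C X → (∀ p → 0ℚ < cross (X p -ᵥ C) (X (p ⁺) -ᵥ C)) → Placement C X
  allConvex-placement C X ccw = placement direction (λ ε ε>0 → cyclic⇒sectorLayout (layout ε ε>0))
    where open AllConvex C X ccw

  oneReflex-placement : ∀ C X → 0ℚ < cross (X 0F -ᵥ C) (X 2F -ᵥ C) → 0ℚ < cross (X 2F -ᵥ C) (X 1F -ᵥ C) →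
    0ℚ ≤ cross (X 0F -ᵥ C) (X 1F -ᵥ C) → Placement C X
  oneReflex-placement C X u₀×u₂>0 u₂×u₁>0 u₀×u₁≥0 = placement direction (λ ε ε>0 → cyclic⇒sectorLayout (layout ε ε>0))
    where open OneReflex C X u₀×u₂>0 u₂×u₁>0 u₀×u₁≥0

  permuted : ∀ {C X} (π : Permutation′ 3) → Placement C (λ a → X (π ⟨$⟩ʳ a)) → Placement C X
  permuted {C} {X} π (placement d L) = placement (λ p → d (π ⟨$⟩ˡ p))
    (λ ε ε>0 → relabel (flip π) (λ a → cong X (sym (inverseʳ π))) (λ _ → refl) (L ε ε>0))

  private
    expand-cross : ∀ a b c → dot a a * cross b c ≡ (- dot a b) * cross c a - cross a b * dot a c
    expand-cross (ax , ay) (bx , by) (cx , cy) = solve 6 (λ ax ay bx by cx cy →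
      (ax :* ax :+ ay :* ay) :* (bx :* cy :- by :* cx)
      := (:- (ax :* bx :+ ay :* by)) :* (cx :* ay :- cy :* ax) :- (ax :* by :- ay :* bx) :* (ax :* cx :+ ay :* cy))
      refl ax ay bx by cx cy

    expand-dot : ∀ a b c → dot a a * dot b c ≡ dot a b * dot a c + cross a b * cross a c
    expand-dot (ax , ay) (bx , by) (cx , cy) = solve 6 (λ ax ay bx by cx cy →
      (ax :* ax :+ ay :* ay) :* (bx :* cx :+ by :* cy)
      := (ax :* bx :+ ay :* by) :* (ax :* cx :+ ay :* cy) :+ (ax :* by :- ay :* bx) :* (ax :* cy :- ay :* cx))
      refl ax ay bx by cx cy

    dot-sym : ∀ a b → dot a b ≡ dot b a
    dot-sym (ax , ay) (bx , by) = solve 4 (λ ax ay bx by → ax :* bx :+ ay :* by := bx :* ax :+ by :* ay) refl ax ay bx by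

    collinear⇒opposite : ∀ {u v} → NotSameDirection u v → cross u v ≡ 0ℚ → dot u v < 0ℚ
    collinear⇒opposite (inj₁ u×v≢0) u×v≡0 = contradiction u×v≡0 u×v≢0
    collinear⇒opposite (inj₂ u·v<0) _     = u·v<0

    record SameSign (x y : ℚ) : Set where
      field
        pos  : 0ℚ < x → 0ℚ < y
        neg  : x < 0ℚ → y < 0ℚ
        null : x ≡ 0ℚ → y ≡ 0ℚ

    sameSign : ∀ {l d x y} → 0ℚ < l → 0ℚ < d → l * x ≡ d * y → SameSign x y
    sameSign {l} {d} {x} {y} l>0 d>0 lx≡dy = record
      { pos  = λ x>0 → *-cancelʳ-pos d>0 (subst (0ℚ <_) (trans lx≡dy (*-comm d y)) (*-pos l>0 x>0))
      ; neg  = λ x<0 → neg-cancel-< (*-cancelʳ-pos d>0 (subst (0ℚ <_) (flip-sign) (*-pos l>0 (neg-antimono-< x<0))))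
      ; null = λ x≡0 → *-cancelˡ-≡0 (λ d≡0 → <-irrefl (sym d≡0) d>0) (trans (sym lx≡dy) (trans (cong (l *_) x≡0) (*-zeroʳ l)))
      }
      where
      flip-sign : l * - x ≡ - y * d
      flip-sign = trans (solve 2 (λ l x → l :* (:- x) := :- (l :* x)) refl l x)
                   (trans (cong -_ (trans lx≡dy (*-comm d y))) (solve 2 (λ y d → :- (y :* d) := (:- y) :* d) refl y d))

  module Classification (C : Point) (X : Fin 3 → Point) (X≢C : ∀ a → X a ≢ C)
    (nsd₀₁ : NotSameDirection (X 0F -ᵥ C) (X 1F -ᵥ C))
    (nsd₁₂ : NotSameDirection (X 1F -ᵥ C) (X 2F -ᵥ C))
    (nsd₂₀ : NotSameDirection (X 2F -ᵥ C) (X 0F -ᵥ C)) where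

    private
      u₀ u₁ u₂ : Point
      u₀ = X 0F -ᵥ C
      u₁ = X 1F -ᵥ C
      u₂ = X 2F -ᵥ C
      k₀₁ k₁₂ k₂₀ : ℚ
      k₀₁ = cross u₀ u₁
      k₁₂ = cross u₁ u₂
      k₂₀ = cross u₂ u₀

      0<|u| : ∀ a → 0ℚ < dot (X a -ᵥ C) (X a -ᵥ C)
      0<|u| a = 0<sqLen C (X a) (λ C≡X → X≢C a (sym C≡X))

      -- Two opposite arms force the third one strictly to one side of both.
      opposite₀₁ : k₀₁ ≡ 0ℚ → SameSign k₁₂ k₂₀
      opposite₀₁ k≡0 = sameSign (0<|u| 0F) (neg-antimono-< (collinear⇒opposite {u₀} {u₁} nsd₀₁ k≡0))
        (trans (expand-cross u₀ u₁ u₂) (trans (cong (λ z → (- dot u₀ u₁) * k₂₀ - z * dot u₀ u₂) k≡0)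
          (solve 2 (λ x y → x :- con 0ℚ :* y := x) refl ((- dot u₀ u₁) * k₂₀) (dot u₀ u₂))))

      opposite₁₂ : k₁₂ ≡ 0ℚ → SameSign k₂₀ k₀₁
      opposite₁₂ k≡0 = sameSign (0<|u| 1F) (neg-antimono-< (collinear⇒opposite {u₁} {u₂} nsd₁₂ k≡0))
        (trans (expand-cross u₁ u₂ u₀) (trans (cong (λ z → (- dot u₁ u₂) * k₀₁ - z * dot u₁ u₀) k≡0)
          (solve 2 (λ x y → x :- con 0ℚ :* y := x) refl ((- dot u₁ u₂) * k₀₁) (dot u₁ u₀))))

      opposite₂₀ : k₂₀ ≡ 0ℚ → SameSign k₀₁ k₁₂
      opposite₂₀ k≡0 = sameSign (0<|u| 2F) (neg-antimono-< (collinear⇒opposite {u₂} {u₀} nsd₂₀ k≡0))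
        (trans (expand-cross u₂ u₀ u₁) (trans (cong (λ z → (- dot u₂ u₀) * k₁₂ - z * dot u₂ u₁) k≡0)
          (solve 2 (λ x y → x :- con 0ℚ :* y := x) refl ((- dot u₂ u₀) * k₁₂) (dot u₂ u₁))))

      -- Three pairwise opposite directions cannot exist: u₁ and u₂ would both oppose u₀, hence agree.
      not-all-opposite : k₀₁ ≡ 0ℚ → k₁₂ ≡ 0ℚ → k₂₀ ≡ 0ℚ → ⊥
      not-all-opposite k₀₁≡0 k₁₂≡0 k₂₀≡0 = <-asym (collinear⇒opposite {u₁} {u₂} nsd₁₂ k₁₂≡0)
        (*-cancelʳ-pos (0<|u| 0F) (subst (0ℚ <_) eq
          (*-neg-neg (collinear⇒opposite {u₀} {u₁} nsd₀₁ k₀₁≡0)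
                     (subst (_< 0ℚ) (dot-sym u₂ u₀) (collinear⇒opposite {u₂} {u₀} nsd₂₀ k₂₀≡0)))))
        where
        eq : dot u₀ u₁ * dot u₀ u₂ ≡ dot u₁ u₂ * dot u₀ u₀
        eq = trans (sym (trans (cong (λ z → dot u₀ u₁ * dot u₀ u₂ + z * cross u₀ u₂) k₀₁≡0)
                                (solve 2 (λ x y → x :+ con 0ℚ :* y := x) refl (dot u₀ u₁ * dot u₀ u₂) (cross u₀ u₂))))
                   (trans (sym (expand-dot u₀ u₁ u₂)) (*-comm (dot u₀ u₀) (dot u₁ u₂)))

      rotate rotate⁻¹ : Permutation′ 3
      rotate   = transpose 1F 2F ∘ₚ transpose 0F 1F
      rotate⁻¹ = transpose 0F 1F ∘ₚ transpose 1F 2F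

      convex : ∀ Y → (∀ p → 0ℚ < cross (Y p -ᵥ C) (Y (p ⁺) -ᵥ C)) → Placement C Y
      convex = allConvex-placement C

      reflex : ∀ Y → 0ℚ < cross (Y 0F -ᵥ C) (Y 2F -ᵥ C) → 0ℚ < cross (Y 2F -ᵥ C) (Y 1F -ᵥ C) →
        0ℚ ≤ cross (Y 0F -ᵥ C) (Y 1F -ᵥ C) → Placement C Y
      reflex = oneReflex-placement C

      classify : Sign k₀₁ → Sign k₁₂ → Sign k₂₀ → Placement C X
      classify (>0 a) (>0 b) (>0 c) = convex X (λ { 0F → a ; 1F → b ; 2F → c })
      classify (<0 a) (<0 b) (<0 c) =
        permuted (transpose 1F 2F)
          (convex _ (λ { 0F → cross-swap-pos u₂ u₀ c ; 1F → cross-swap-pos u₁ u₂ b ; 2F → cross-swap-pos u₀ u₁ a }))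
      classify (>0 a) (>0 b) (<0 c) = permuted (transpose 1F 2F) (reflex _ a b (cross-swap-nonNeg u₂ u₀ (<⇒≤ c)))
      classify (>0 a) (>0 b) (≡0 c) = permuted (transpose 1F 2F) (reflex _ a b (cross-swap-nonNeg u₂ u₀ (≤-reflexive c)))
      classify (>0 a) (<0 b) (>0 c) = permuted (transpose 0F 2F) (reflex _ c a (cross-swap-nonNeg u₁ u₂ (<⇒≤ b)))
      classify (>0 a) (≡0 b) (>0 c) = permuted (transpose 0F 2F) (reflex _ c a (cross-swap-nonNeg u₁ u₂ (≤-reflexive b)))
      classify (<0 a) (>0 b) (>0 c) = permuted (transpose 0F 1F) (reflex _ b c (cross-swap-nonNeg u₀ u₁ (<⇒≤ a)))
      classify (≡0 a) (>0 b) (>0 c) = permuted (transpose 0F 1F) (reflex _ b c (cross-swap-nonNeg u₀ u₁ (≤-reflexive a)))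
      classify (>0 a) (<0 b) (<0 c) = reflex X (cross-swap-pos u₂ u₀ c) (cross-swap-pos u₁ u₂ b) (<⇒≤ a)
      classify (≡0 a) (<0 b) (<0 c) = reflex X (cross-swap-pos u₂ u₀ c) (cross-swap-pos u₁ u₂ b) (≤-reflexive (sym a))
      classify (<0 a) (>0 b) (<0 c) = permuted rotate (reflex _ (cross-swap-pos u₀ u₁ a) (cross-swap-pos u₂ u₀ c) (<⇒≤ b))
      classify (<0 a) (≡0 b) (<0 c) = permuted rotate (reflex _ (cross-swap-pos u₀ u₁ a) (cross-swap-pos u₂ u₀ c) (≤-reflexive (sym b)))
      classify (<0 a) (<0 b) (>0 c) = permuted rotate⁻¹ (reflex _ (cross-swap-pos u₁ u₂ b) (cross-swap-pos u₀ u₁ a) (<⇒≤ c))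
      classify (<0 a) (<0 b) (≡0 c) = permuted rotate⁻¹ (reflex _ (cross-swap-pos u₁ u₂ b) (cross-swap-pos u₀ u₁ a) (≤-reflexive (sym c)))
      classify (≡0 a) (>0 b) (<0 c) = contradiction (SameSign.pos (opposite₀₁ a) b) (<-asym c)
      classify (≡0 a) (<0 b) (>0 c) = contradiction (SameSign.neg (opposite₀₁ a) b) (<-asym c)
      classify (>0 a) (≡0 b) (<0 c) = contradiction (SameSign.neg (opposite₁₂ b) c) (<-asym a)
      classify (<0 a) (≡0 b) (>0 c) = contradiction (SameSign.pos (opposite₁₂ b) c) (<-asym a)
      classify (>0 a) (<0 b) (≡0 c) = contradiction (SameSign.pos (opposite₂₀ c) a) (<-asym b)
      classify (<0 a) (>0 b) (≡0 c) = contradiction (SameSign.neg (opposite₂₀ c) a) (<-asym b)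
      classify (≡0 a) (≡0 b) _      = ⊥-elim (not-all-opposite a b (SameSign.null (opposite₀₁ a) b))
      classify (≡0 a) _      (≡0 c) = ⊥-elim (not-all-opposite a (SameSign.null (opposite₂₀ c) a) c)
      classify _      (≡0 b) (≡0 c) = ⊥-elim (not-all-opposite (SameSign.null (opposite₁₂ b) c) b c)

    arms-placement : Placement C X
    arms-placement = classify (sign k₀₁) (sign k₁₂) (sign k₂₀)

  -- Position suc q of a gadget is the new clause omitting the arm opposite q, as in red1Clause.
  Adjacent : Fin 4 → Fin 3 → Set
  Adjacent zero    a = ⊤
  Adjacent (suc q) a = a ≢ opposite q

  module Neighbourhood (C : Point) (X : Fin 3 → Point) (X≢C : ∀ a → X a ≢ C)
    (X-injective : ∀ {a b} → X a ≡ X b → a ≡ b)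
    (nsd : ∀ a b → a ≢ b → NotSameDirection (X a -ᵥ C) (X b -ᵥ C))
    {P : Fin 3 → Point} (L : SectorLayout C X P) where

    open SectorLayout L

    vertex : Fin 4 → Point
    vertex zero    = C
    vertex (suc q) = P (opposite q)

    Region : Fin 4 → Fin 3 → Point → Set
    Region zero    a t = t ≡ C ⊎ Ray C (X a) t
    Region (suc q) a t = Sector (opposite q) t

    private
      opposite-injective : ∀ {q r : Fin 3} → opposite q ≡ opposite r → q ≡ r
      opposite-injective {q} {r} eq = trans (sym (opposite-involutive q)) (trans (cong opposite eq) (opposite-involutive r))

      same-ray : ∀ {a b t} → Ray C (X a) t → Ray C (X b) t → a ≡ b
      same-ray {a} {b} {t} ra rb with a ≟ᶠ b
      ... | yes a≡b = a≡b
      ... | no  a≢b = ⊥-elim (rays-disjoint {C} {X a} {X b} {t} (X≢C a) (nsd a b a≢b) ra rb)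

      apex∈sector : ∀ p → Sector p (P p)
      apex∈sector p = either (segment⊆sector p (p ⁺) (⁺≢id p) (onSeg-start (P p) (X (p ⁺))))
                             (segment⊆sector p (p ⁻) (⁻≢id p) (onSeg-start (P p) (X (p ⁻))))
        where
        either : P p ≡ X (p ⁺) ⊎ Sector p (P p) → P p ≡ X (p ⁻) ⊎ Sector p (P p) → Sector p (P p)
        either (inj₂ s)   _          = s
        either (inj₁ _)   (inj₂ s)   = s
        either (inj₁ P≡⁺) (inj₁ P≡⁻) = ⊥-elim (⁺≢⁻ p (X-injective (trans (sym P≡⁺) P≡⁻)))

      vertex∈sector : ∀ q → Sector (opposite q) (vertex (suc q))
      vertex∈sector q = apex∈sector (opposite q)

      arm∈region : ∀ k a b → Region k b (X a) → a ≡ b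
      arm∈region zero    a b (inj₁ Xa≡C) = ⊥-elim (X≢C a Xa≡C)
      arm∈region zero    a b (inj₂ r)    = same-ray {a} {b} {X a} (ray-end C (X a)) r
      arm∈region (suc q) a b s           = ⊥-elim (sector∩ray (opposite q) a s (ray-end C (X a)))

      disjoint-sectors : ∀ q r {t} → Sector (opposite q) t → Sector (opposite r) t → q ≡ r
      disjoint-sectors q r s s′ with q ≟ᶠ r
      ... | yes q≡r = q≡r
      ... | no  q≢r = ⊥-elim (sectors-disjoint (opposite q) (opposite r) (q≢r ∘ opposite-injective) s s′)

    edge⊆region : ∀ k a → Adjacent k a → ∀ {t} → OnSeg (vertex k) (X a) t → t ≡ X a ⊎ Region k a t
    edge⊆region zero    a _   {t} t∈ = inj₂ (onSeg⇒ray {C} {X a} {t} t∈)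
    edge⊆region (suc q) a a≢q t∈ = segment⊆sector (opposite q) a a≢q t∈

    EdgesMeet : Fin 4 → Fin 3 → Fin 4 → Fin 3 → Point → Set
    EdgesMeet k a l b t = (k ≡ l × a ≡ b) ⊎ ((k ≡ l × t ≡ vertex k) ⊎ (a ≡ b × t ≡ X a))

    private
      regions-meet : ∀ k a l b → Adjacent k a → Adjacent l b → ∀ {t} →
        OnSeg (vertex k) (X a) t → OnSeg (vertex l) (X b) t → Region k a t → Region l b t → EdgesMeet k a l b t
      regions-meet zero a zero b _ _ _ _ (inj₁ t≡C) _          = inj₂ (inj₁ (refl , t≡C))
      regions-meet zero a zero b _ _ _ _ (inj₂ _)   (inj₁ t≡C) = inj₂ (inj₁ (refl , t≡C))
      regions-meet zero a zero b _ _ {t} _ _ (inj₂ ra) (inj₂ rb) = inj₁ (refl , same-ray {a} {b} {t} ra rb)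
      regions-meet zero a (suc r) b _ _ _ _ (inj₁ refl) s = ⊥-elim (centre∉sector (opposite r) s)
      regions-meet zero a (suc r) b _ _ _ _ (inj₂ ra)   s = ⊥-elim (sector∩ray (opposite r) a s ra)
      regions-meet (suc q) a zero b _ _ _ _ s (inj₁ refl) = ⊥-elim (centre∉sector (opposite q) s)
      regions-meet (suc q) a zero b _ _ _ _ s (inj₂ rb)   = ⊥-elim (sector∩ray (opposite q) b s rb)
      regions-meet (suc q) a (suc r) b a≢ b≢ t∈a t∈b s s′ with disjoint-sectors q r s s′
      ... | refl with a ≟ᶠ b
      ...   | yes a≡b = inj₁ (refl , a≡b)
      ...   | no  a≢b = inj₂ (inj₁ (refl , meet-at-apex (opposite q) a b a≢ b≢ a≢b t∈a t∈b))

    edges-meet : ∀ k a l b → Adjacent k a → Adjacent l b → ∀ {t} →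
      OnSeg (vertex k) (X a) t → OnSeg (vertex l) (X b) t → EdgesMeet k a l b t
    edges-meet k a l b adj-a adj-b {t} t∈a t∈b = cases (edge⊆region k a adj-a t∈a) (edge⊆region l b adj-b t∈b)
      where
      cases : t ≡ X a ⊎ Region k a t → t ≡ X b ⊎ Region l b t → EdgesMeet k a l b t
      cases (inj₁ t≡Xa) (inj₁ t≡Xb) = inj₂ (inj₂ (X-injective (trans (sym t≡Xa) t≡Xb) , t≡Xa))
      cases (inj₁ t≡Xa) (inj₂ reg)  = inj₂ (inj₂ (arm∈region l a b (subst (Region l b) t≡Xa reg) , t≡Xa))
      cases (inj₂ reg)  (inj₁ t≡Xb) = inj₂ (inj₂ (sym b≡a , trans t≡Xb (cong X b≡a)))
        where
        b≡a : b ≡ a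
        b≡a = arm∈region k b a (subst (Region k a) t≡Xb reg)
      cases (inj₂ reg)  (inj₂ reg′) = regions-meet k a l b adj-a adj-b t∈a t∈b reg reg′

    vertex-on-edge : ∀ k a l → Adjacent k a → OnSeg (vertex k) (X a) (vertex l) → l ≡ k
    vertex-on-edge k a l adj on = cases k l (edge⊆region k a adj on)
      where
      cases : ∀ k l → vertex l ≡ X a ⊎ Region k a (vertex l) → l ≡ k
      cases _       zero    (inj₁ C≡Xa) = ⊥-elim (X≢C a (sym C≡Xa))
      cases _       (suc r) (inj₁ P≡Xa) =
        ⊥-elim (sector∩ray (opposite r) a (subst (Sector (opposite r)) P≡Xa (vertex∈sector r)) (ray-end C (X a)))
      cases zero    zero    (inj₂ _)           = refl
      cases zero    (suc r) (inj₂ (inj₁ P≡C))  =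
        ⊥-elim (centre∉sector (opposite r) (subst (Sector (opposite r)) P≡C (vertex∈sector r)))
      cases zero    (suc r) (inj₂ (inj₂ ray))  = ⊥-elim (sector∩ray (opposite r) a (vertex∈sector r) ray)
      cases (suc q) zero    (inj₂ s)           = ⊥-elim (centre∉sector (opposite q) s)
      cases (suc q) (suc r) (inj₂ s)           = cong suc (disjoint-sectors r q (vertex∈sector r) s)

    vertex-injective : ∀ k l → vertex k ≡ vertex l → k ≡ l
    vertex-injective zero    zero    _   = refl
    vertex-injective zero    (suc r) C≡P =
      ⊥-elim (centre∉sector (opposite r) (subst (Sector (opposite r)) (sym C≡P) (vertex∈sector r)))
    vertex-injective (suc q) zero    P≡C =
      ⊥-elim (centre∉sector (opposite q) (subst (Sector (opposite q)) P≡C (vertex∈sector q)))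
    vertex-injective (suc q) (suc r) P≡P =
      cong suc (disjoint-sectors q r (subst (Sector (opposite q)) P≡P (vertex∈sector q)) (vertex∈sector r))

module Indexing where

  open import Defs
  open import Data.Fin using (Fin; zero; suc; _↑ˡ_; _↑ʳ_)
  open import Data.Fin.Patterns using (0F; 1F; 2F; 3F)
  open import Data.List using (_∷_; length)
  import Data.List as List
  open import Data.List.Relation.Unary.All using (All; _∷_)
  open import Data.List.Relation.Unary.Any using (here; there)
  open import Data.Product using (_×_; _,_; proj₁; proj₂; Σ-syntax)
  import Data.Product as Product
  open import Relation.Binary.PropositionalEquality
  open import Relation.Nullary using (contradiction)
  open SectorLayouts using (Adjacent)

  clauseAt : ∀ {n} (f : MonoFormula n) → Fin (length (toCNF f)) → MClause n
  clauseAt (c ∷ f) zero    = c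
  clauseAt (c ∷ f) (suc j) = clauseAt f j

  lookup-toCNF : ∀ {n} (f : MonoFormula n) j → List.lookup (toCNF f) j ≡ toClause (clauseAt f j)
  lookup-toCNF (c ∷ f) zero    = refl
  lookup-toCNF (c ∷ f) (suc j) = lookup-toCNF f j

  distinctAt : ∀ {n} (f : MonoFormula n) → All Distinct3 f → ∀ j → Distinct3 (clauseAt f j)
  distinctAt (c ∷ f) (d ∷ _)  zero    = d
  distinctAt (c ∷ f) (_ ∷ ds) (suc j) = distinctAt f ds j

  -- split f i = (j , k) when clause i of red1 f is clause k of red1Clause (clauseAt f j).
  split : ∀ {n} (f : MonoFormula n) → Fin (length (red1 f)) → Fin (length (toCNF f)) × Fin 4
  split (c ∷ f) 0F                        = zero , 0F
  split (c ∷ f) 1F                        = zero , 1F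
  split (c ∷ f) 2F                        = zero , 2F
  split (c ∷ f) 3F                        = zero , 3F
  split (c ∷ f) (suc (suc (suc (suc i)))) = Product.map₁ suc (split f i)

  join : ∀ {n} (f : MonoFormula n) → Fin (length (toCNF f)) × Fin 4 → Fin (length (red1 f))
  join (c ∷ f) (zero  , k) = k ↑ˡ length (red1 f)
  join (c ∷ f) (suc j , k) = 4 ↑ʳ join f (j , k)

  join-split : ∀ {n} (f : MonoFormula n) i → join f (split f i) ≡ i
  join-split (c ∷ f) 0F                        = refl
  join-split (c ∷ f) 1F                        = refl
  join-split (c ∷ f) 2F                        = refl
  join-split (c ∷ f) 3F                        = refl
  join-split (c ∷ f) (suc (suc (suc (suc i)))) = cong (4 ↑ʳ_) (join-split f i)

  split-injective : ∀ {n} (f : MonoFormula n) {i i′} → split f i ≡ split f i′ → i ≡ i′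
  split-injective f {i} {i′} eq = trans (sym (join-split f i)) (trans (cong (join f) eq) (join-split f i′))

  lookup-red1 : ∀ {n} (f : MonoFormula n) i →
    List.lookup (red1 f) i ≡ List.lookup (red1Clause (clauseAt f (proj₁ (split f i)))) (proj₂ (split f i))
  lookup-red1 (c ∷ f) 0F                        = refl
  lookup-red1 (c ∷ f) 1F                        = refl
  lookup-red1 (c ∷ f) 2F                        = refl
  lookup-red1 (c ∷ f) 3F                        = refl
  lookup-red1 (c ∷ f) (suc (suc (suc (suc i)))) = lookup-red1 f i

  arm : ∀ {n} → MClause n → Fin 3 → Fin n
  arm (x , y , z) 0F = x
  arm (x , y , z) 1F = y
  arm (x , y , z) 2F = z

  arm-injective : ∀ {n} (c : MClause n) → Distinct3 c → ∀ {a b} → arm c a ≡ arm c b → a ≡ b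
  arm-injective c           _                 {0F} {0F} _   = refl
  arm-injective c           _                 {1F} {1F} _   = refl
  arm-injective c           _                 {2F} {2F} _   = refl
  arm-injective (x , y , z) (x≢y , x≢z , y≢z) {0F} {1F} x≡y = contradiction x≡y x≢y
  arm-injective (x , y , z) (x≢y , x≢z , y≢z) {0F} {2F} x≡z = contradiction x≡z x≢z
  arm-injective (x , y , z) (x≢y , x≢z , y≢z) {1F} {0F} y≡x = contradiction (sym y≡x) x≢y
  arm-injective (x , y , z) (x≢y , x≢z , y≢z) {1F} {2F} y≡z = contradiction y≡z y≢z
  arm-injective (x , y , z) (x≢y , x≢z , y≢z) {2F} {0F} z≡x = contradiction (sym z≡x) x≢z
  arm-injective (x , y , z) (x≢y , x≢z , y≢z) {2F} {1F} z≡y = contradiction (sym z≡y) y≢z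

  arm-occurs : ∀ {n} (c : MClause n) a → OccursIn (arm c a) (toClause c)
  arm-occurs (x , y , z) 0F = here refl
  arm-occurs (x , y , z) 1F = there (here refl)
  arm-occurs (x , y , z) 2F = there (there (here refl))

  occurs-red1Clause : ∀ {n} (c : MClause n) k v → OccursIn v (List.lookup (red1Clause c) k) →
    Σ[ a ∈ Fin 3 ] Adjacent k a × v ≡ arm c a
  occurs-red1Clause (x , y , z) 0F v (here e)                 = 0F , _ , sym e
  occurs-red1Clause (x , y , z) 0F v (there (here e))         = 1F , _ , sym e
  occurs-red1Clause (x , y , z) 0F v (there (there (here e))) = 2F , _ , sym e
  occurs-red1Clause (x , y , z) 1F v (here e)                 = 0F , (λ ()) , sym e
  occurs-red1Clause (x , y , z) 1F v (there (here e))         = 1F , (λ ()) , sym e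
  occurs-red1Clause (x , y , z) 2F v (here e)                 = 0F , (λ ()) , sym e
  occurs-red1Clause (x , y , z) 2F v (there (here e))         = 2F , (λ ()) , sym e
  occurs-red1Clause (x , y , z) 3F v (here e)                 = 2F , (λ ()) , sym e
  occurs-red1Clause (x , y , z) 3F v (there (here e))         = 1F , (λ ()) , sym e

module FiniteBounds where

  open RationalSigns
  open import Data.Rational using (ℚ; 0ℚ; 1ℚ; _<_; _≤_; _⊓_; _⊔_)
  open import Data.Rational.Properties using (≤-refl; ≤-trans; p⊓q≤p; p⊓q≤q; p≤p⊔q; p≤q⊔p)
  open import Data.Fin using (Fin)
  open import Data.List using (List; []; _∷_; _++_; map; allFin)
  open import Data.List.Membership.Propositional using (_∈_)
  open import Data.List.Membership.Propositional.Properties using (∈-++⁺ˡ; ∈-++⁺ʳ; ∈-map⁺; ∈-allFin)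
  open import Data.List.Relation.Unary.Any using (here; there)
  open import Data.Product using (_×_; _,_; Σ-syntax)
  open import Data.Sum using (_⊎_; inj₁; inj₂)
  open import Relation.Binary.PropositionalEquality using (refl)

  lower-bound : ∀ {A : Set} (g : A → ℚ) → (∀ x → 0ℚ < g x) → (xs : List A) →
    Σ[ δ ∈ ℚ ] 0ℚ < δ × (∀ {x} → x ∈ xs → δ ≤ g x)
  lower-bound g g>0 []       = 1ℚ , 0<1 , λ ()
  lower-bound g g>0 (y ∷ xs) =
    let δ , δ>0 , δ≤ = lower-bound g g>0 xs
    in g y ⊓ δ , ⊓-pos (g>0 y) δ>0 ,
       λ { (here refl) → p⊓q≤p (g y) δ ; (there x∈) → ≤-trans (p⊓q≤q (g y) δ) (δ≤ x∈) }

  upper-bound : ∀ {A : Set} (g : A → ℚ) (xs : List A) → Σ[ K ∈ ℚ ] 0ℚ ≤ K × (∀ {x} → x ∈ xs → g x ≤ K)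
  upper-bound g []       = 0ℚ , ≤-refl , λ ()
  upper-bound g (y ∷ xs) =
    let K , K≥0 , ≤K = upper-bound g xs
    in g y ⊔ K , ≤-trans K≥0 (p≤q⊔p (g y) K) ,
       λ { (here refl) → p≤p⊔q (g y) K ; (there x∈) → ≤-trans (≤K x∈) (p≤q⊔p (g y) K) }

  vertices : ∀ n m → List (Fin n ⊎ Fin m)
  vertices n m = map inj₁ (allFin n) ++ map inj₂ (allFin m)

  ∈-vertices : ∀ {n m} v → v ∈ vertices n m
  ∈-vertices     (inj₁ a) = ∈-++⁺ˡ (∈-map⁺ inj₁ (∈-allFin a))
  ∈-vertices {n} (inj₂ b) = ∈-++⁺ʳ (map inj₁ (allFin n)) (∈-map⁺ inj₂ (∈-allFin b))

module Planarity where

  open import Defs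
  open import Data.Nat using (ℕ)
  open import Data.List.Relation.Unary.All using (All)
  open import Data.Product using (_×_; _,_; proj₁; proj₂; Σ; Σ-syntax)
  open import Data.Sum using (_⊎_; inj₁; inj₂; [_,_]′; swap)
  open import Data.Empty using (⊥; ⊥-elim)
  open import Relation.Binary.PropositionalEquality
  open import Relation.Nullary using (¬_; Dec; yes; no; contradiction)

  module Construction {n : ℕ} (f : MonoFormula n) (distinct : All Distinct3 f)
    (place : BipV (toCNF f) → Point)
    (place-injective : ∀ u v → place u ≡ place v → u ≡ v)
    (on-edge : ∀ a b v → BipE (toCNF f) a b → OnSeg (place a) (place b) (place v) → (v ≡ a ⊎ v ≡ b))
    (edges-meet : ∀ a b c d t → BipE (toCNF f) a b → BipE (toCNF f) c d →
       OnSeg (place a) (place b) t → OnSeg (place c) (place d) t →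
       ((a ≡ c × b ≡ d) ⊎ (a ≡ d × b ≡ c)) ⊎
       Σ (BipV (toCNF f)) λ v → (v ≡ a ⊎ v ≡ b) × (v ≡ c ⊎ v ≡ d) × (t ≡ place v)) where

    open RationalSigns
    open Plane
    open Separation
    open Perturbation
    open Wedges
    open SectorLayouts
    open Indexing
    open FiniteBounds
    open import Data.Rational using (ℚ; 0ℚ; 1ℚ; _+_; _<_; _≤_; _⊓_)
    open import Data.Rational.Properties using (≤-trans; p⊓q≤p; p⊓q≤q; +-monoʳ-≤; *-zeroˡ; +-identityʳ)
    open import Data.Fin using (Fin; zero; suc; opposite)
    open import Data.Fin.Patterns using (0F; 1F; 2F)
    open import Data.Fin.Properties using () renaming (_≟_ to _≟ᶠ_)
    open import Data.List using (List; length; allFin; cartesianProduct)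
    import Data.List as List
    open import Data.List.Membership.Propositional.Properties using (∈-allFin; ∈-cartesianProduct⁺)
    open import Data.Sum.Properties using (inj₁-injective; inj₂-injective)
    open import Function using (_∘_; const)
    open import Data.Product using (uncurry)
    open import Data.List.Membership.Propositional using (_∈_)

    private
      V V′ Clause₀ : Set
      V       = BipV (toCNF f)
      V′      = BipV (red1 f)
      Clause₀ = Fin (length (toCNF f))

    centre : Clause₀ → Point
    centre j = place (inj₂ j)

    armVar : Clause₀ → Fin 3 → Fin n
    armVar j = arm (clauseAt f j)

    armAt : Clause₀ → Fin 3 → Point
    armAt j a = place (inj₁ (armVar j a))

    old-edge : ∀ j a → BipE (toCNF f) (inj₂ j) (inj₁ (armVar j a))
    old-edge j a = subst (OccursIn (armVar j a)) (sym (lookup-toCNF f j)) (arm-occurs (clauseAt f j) a)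

    private
      inj₁≢inj₂ : ∀ {A B : Set} {a : A} {b : B} → inj₁ a ≢ inj₂ b
      inj₁≢inj₂ ()

    arm≢centre : ∀ j a → armAt j a ≢ centre j
    arm≢centre j a eq = inj₁≢inj₂ (place-injective _ _ eq)

    armAt-injective : ∀ j {a b} → armAt j a ≡ armAt j b → a ≡ b
    armAt-injective j eq = arm-injective (clauseAt f j) (distinctAt f distinct j) (inj₁-injective (place-injective _ _ eq))

    arm-on-edge : ∀ j a b → OnSeg (centre j) (armAt j b) (armAt j a) → a ≡ b
    arm-on-edge j a b on = endpoint (on-edge (inj₂ j) (inj₁ (armVar j b)) (inj₁ (armVar j a)) (old-edge j b) on)
      where
      endpoint : inj₁ (armVar j a) ≡ inj₂ j ⊎ inj₁ (armVar j a) ≡ inj₁ (armVar j b) → a ≡ b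
      endpoint (inj₁ ())
      endpoint (inj₂ eq) = armAt-injective j (cong place eq)

    arms-notSameDirection : ∀ j a b → a ≢ b → NotSameDirection (armAt j a -ᵥ centre j) (armAt j b -ᵥ centre j)
    arms-notSameDirection j a b a≢b = by (notSameDirection⊎nested (centre j) (armAt j a) (armAt j b)
                                             (λ eq → arm≢centre j a (sym eq)) (λ eq → arm≢centre j b (sym eq)))
      where
      by : NotSameDirection (armAt j a -ᵥ centre j) (armAt j b -ᵥ centre j) ⊎
           (OnSeg (centre j) (armAt j b) (armAt j a) ⊎ OnSeg (centre j) (armAt j a) (armAt j b)) →
           NotSameDirection (armAt j a -ᵥ centre j) (armAt j b -ᵥ centre j)
      by (inj₁ nsd)        = nsd
      by (inj₂ (inj₁ a∈b)) = contradiction (arm-on-edge j a b a∈b) a≢b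
      by (inj₂ (inj₂ b∈a)) = contradiction (sym (arm-on-edge j b a b∈a)) a≢b

    placementAt : ∀ j → Placement (centre j) (armAt j)
    placementAt j = Classification.arms-placement (centre j) (armAt j) (arm≢centre j)
      (arms-notSameDirection j 0F 1F (λ ())) (arms-notSameDirection j 1F 2F (λ ())) (arms-notSameDirection j 2F 0F (λ ()))

    direction : Clause₀ → Fin 3 → Point
    direction j = Placement.direction (placementAt j)

    private
      arms : List (Clause₀ × Fin 3)
      arms = cartesianProduct (allFin (length (toCNF f))) (allFin 3)

      bound : Σ[ B ∈ ℚ ] 0ℚ ≤ B × (∀ {x} → x ∈ arms → sqNorm (uncurry direction x) ≤ B)
      bound = upper-bound (uncurry λ j p → sqNorm (direction j p)) arms

    K : ℚ
    K = 1ℚ + proj₁ bound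

    0<K : 0ℚ < K
    0<K = +-pos 0<1 (proj₁ (proj₂ bound))

    direction≤K : ∀ j p → 1ℚ + sqNorm (direction j p) ≤ K
    direction≤K j p = +-monoʳ-≤ 1ℚ (proj₂ (proj₂ bound) (∈-cartesianProduct⁺ (∈-allFin j) (∈-allFin p)))

    still≤K : 1ℚ + sqNorm (0ℚ , 0ℚ) ≤ K
    still≤K = +-monoʳ-≤ 1ℚ (subst (_≤ proj₁ bound) (sym (trans (cong₂ _+_ (*-zeroˡ 0ℚ) (*-zeroˡ 0ℚ)) (+-identityʳ 0ℚ)))
                                  (proj₁ (proj₂ bound)))

    tolerance₄ : V × V × V × V → ℚ
    tolerance₄ (a , b , c , d) = [ tolerance K 0<K , const 1ℚ ]′ (separated⊎meet (place a) (place b) (place c) (place d))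

    tolerance₃ : V × V × V → ℚ
    tolerance₃ (x , c , c′) = [ toleranceAt K 0<K , const 1ℚ ]′ (separatedAt⊎degenerate (place x) (place c) (place c′))

    private
      0<[_,1] : ∀ {A B : Set} {g : A → ℚ} → (∀ a → 0ℚ < g a) → (r : A ⊎ B) → 0ℚ < [ g , const 1ℚ ]′ r
      0<[ g>0 ,1] (inj₁ a) = g>0 a
      0<[ g>0 ,1] (inj₂ _) = 0<1

      0<tolerance₄ : ∀ q → 0ℚ < tolerance₄ q
      0<tolerance₄ (a , b , c , d) = 0<[ 0<tolerance K 0<K ,1] (separated⊎meet (place a) (place b) (place c) (place d))

      0<tolerance₃ : ∀ q → 0ℚ < tolerance₃ q
      0<tolerance₃ (x , c , c′) = 0<[ 0<toleranceAt K 0<K ,1] (separatedAt⊎degenerate (place x) (place c) (place c′))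

      Vs : List V
      Vs = vertices n (length (toCNF f))

      δ₄ : Σ[ δ ∈ ℚ ] 0ℚ < δ × (∀ {q} → q ∈ cartesianProduct Vs (cartesianProduct Vs (cartesianProduct Vs Vs)) → δ ≤ tolerance₄ q)
      δ₄ = lower-bound tolerance₄ 0<tolerance₄ (cartesianProduct Vs (cartesianProduct Vs (cartesianProduct Vs Vs)))

      δ₃ : Σ[ δ ∈ ℚ ] 0ℚ < δ × (∀ {q} → q ∈ cartesianProduct Vs (cartesianProduct Vs Vs) → δ ≤ tolerance₃ q)
      δ₃ = lower-bound tolerance₃ 0<tolerance₃ (cartesianProduct Vs (cartesianProduct Vs Vs))

    -- Small enough that every strict separation of old configurations survives moving the new clause
    -- vertices by ε · direction away from the old ones.
    ε : ℚ
    ε = proj₁ δ₄ ⊓ proj₁ δ₃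

    0<ε : 0ℚ < ε
    0<ε = ⊓-pos (proj₁ (proj₂ δ₄)) (proj₁ (proj₂ δ₃))

    ε≤tolerance₄ : ∀ a b c d → ε ≤ tolerance₄ (a , b , c , d)
    ε≤tolerance₄ a b c d = ≤-trans (p⊓q≤p (proj₁ δ₄) (proj₁ δ₃)) (proj₂ (proj₂ δ₄)
      (∈-cartesianProduct⁺ (∈-vertices a) (∈-cartesianProduct⁺ (∈-vertices b) (∈-cartesianProduct⁺ (∈-vertices c) (∈-vertices d)))))

    ε≤tolerance₃ : ∀ x c c′ → ε ≤ tolerance₃ (x , c , c′)
    ε≤tolerance₃ x c c′ = ≤-trans (p⊓q≤q (proj₁ δ₄) (proj₁ δ₃)) (proj₂ (proj₂ δ₃)
      (∈-cartesianProduct⁺ (∈-vertices x) (∈-cartesianProduct⁺ (∈-vertices c) (∈-vertices c′))))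

    separated-robust : ∀ a b c d → ¬ Meet (place a) (place b) (place c) (place d) → ∀ {A′ B′ C′ D′} →
      Displaced ε K (place a) A′ → Displaced ε K (place b) B′ → Displaced ε K (place c) C′ → Displaced ε K (place d) D′ →
      Separated A′ B′ C′ D′
    separated-robust a b c d no-meet {A′} {B′} {C′} {D′} dA dB dC dD =
      by (separated⊎meet (place a) (place b) (place c) (place d)) (ε≤tolerance₄ a b c d)
      where
      by : (r : Separated (place a) (place b) (place c) (place d) ⊎ Meet (place a) (place b) (place c) (place d)) →
           ε ≤ [ tolerance K 0<K , const 1ℚ ]′ r → Separated A′ B′ C′ D′
      by (inj₁ s)    ε≤ = Separated-displaced 0<K s 0<ε ε≤ dA dB dC dD
      by (inj₂ meet) _  = ⊥-elim (no-meet meet)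

    separatedAt-robust : ∀ x c c′ → ¬ Degenerate (place x) (place c) (place c′) → ∀ {P′ Q′} →
      Displaced ε K (place c) P′ → Displaced ε K (place c′) Q′ → SeparatedAt (place x) P′ Q′
    separatedAt-robust x c c′ nondegenerate {P′} {Q′} dP dQ =
      by (separatedAt⊎degenerate (place x) (place c) (place c′)) (ε≤tolerance₃ x c c′)
      where
      by : (r : SeparatedAt (place x) (place c) (place c′) ⊎ Degenerate (place x) (place c) (place c′)) →
           ε ≤ [ toleranceAt K 0<K , const 1ℚ ]′ r → SeparatedAt (place x) P′ Q′
      by (inj₁ s)   ε≤ = SeparatedAt-displaced 0<K s 0<ε ε≤ dP dQ
      by (inj₂ deg) _  = ⊥-elim (nondegenerate deg)

    module Gadget (j : Clause₀) = Neighbourhood (centre j) (armAt j) (arm≢centre j) (armAt-injective j)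
      (arms-notSameDirection j) (Placement.layout (placementAt j) ε 0<ε)

    clauseOf : Fin (length (red1 f)) → Clause₀
    clauseOf i = proj₁ (split f i)

    slot : Fin (length (red1 f)) → Fin 4
    slot i = proj₂ (split f i)

    place′ : V′ → Point
    place′ (inj₁ v) = place (inj₁ v)
    place′ (inj₂ i) = Gadget.vertex (clauseOf i) (slot i)

    old : V′ → V
    old (inj₁ v) = inj₁ v
    old (inj₂ i) = inj₂ (clauseOf i)

    displacement : ∀ w → Displaced ε K (place (old w)) (place′ w)
    displacement (inj₁ v) = displaced (0ℚ , 0ℚ) still≤K (sym (⊕-zero-vector (place (inj₁ v)) ε))
    displacement (inj₂ i) = gadget (slot i)
      where
      gadget : ∀ k → Displaced ε K (centre (clauseOf i)) (Gadget.vertex (clauseOf i) k)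
      gadget zero    = displaced (0ℚ , 0ℚ) still≤K (sym (⊕-zero-vector (centre (clauseOf i)) ε))
      gadget (suc q) = displaced (direction (clauseOf i) (opposite q)) (direction≤K (clauseOf i) (opposite q)) refl

    disjoint-stays-disjoint : ∀ a b c d → ¬ Meet (place (old a)) (place (old b)) (place (old c)) (place (old d)) →
      ∀ {t} → OnSeg (place′ a) (place′ b) t → OnSeg (place′ c) (place′ d) t → ⊥
    disjoint-stays-disjoint a b c d no-meet = separated⇒disjoint
      (separated-robust (old a) (old b) (old c) (old d) no-meet (displacement a) (displacement b) (displacement c) (displacement d))

    separatedAt-stays : ∀ x c c′ → ¬ Degenerate (place (inj₁ x)) (place (old c)) (place (old c′)) →
      ∀ {t} → OnSeg (place (inj₁ x)) (place′ c) t → OnSeg (place (inj₁ x)) (place′ c′) t → t ≡ place (inj₁ x)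
    separatedAt-stays x c c′ nondegenerate = separatedAt⇒meet-at-apex
      (separatedAt-robust (inj₁ x) (old c) (old c′) nondegenerate (displacement c) (displacement c′))

    points-stay-apart : ∀ u w → old u ≢ old w → place′ u ≢ place′ w
    points-stay-apart u w old≢ place′≡ = disjoint-stays-disjoint u u w w no-meet
      (onSeg-start (place′ u) (place′ u)) (subst (λ z → OnSeg z z (place′ u)) place′≡ (onSeg-start (place′ u) (place′ u)))
      where
      no-meet : ¬ Meet (place (old u)) (place (old u)) (place (old w)) (place (old w))
      no-meet (t , t∈u , t∈w) = old≢ (place-injective _ _ (trans (sym (onSeg-degenerate t∈u)) (onSeg-degenerate t∈w)))

    place′-injective : ∀ u w → place′ u ≡ place′ w → u ≡ w
    place′-injective (inj₁ a) (inj₁ b) eq = cong inj₁ (inj₁-injective (place-injective _ _ eq))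
    place′-injective (inj₁ a) (inj₂ i) eq = ⊥-elim (points-stay-apart (inj₁ a) (inj₂ i) inj₁≢inj₂ eq)
    place′-injective (inj₂ i) (inj₁ a) eq = ⊥-elim (points-stay-apart (inj₂ i) (inj₁ a) (inj₁≢inj₂ ∘ sym) eq)
    place′-injective (inj₂ i) (inj₂ i′) eq = by (clauseOf i ≟ᶠ clauseOf i′)
      where
      by : Dec (clauseOf i ≡ clauseOf i′) → inj₂ i ≡ inj₂ i′
      by (no  j≢j′) = ⊥-elim (points-stay-apart (inj₂ i) (inj₂ i′) (j≢j′ ∘ inj₂-injective) eq)
      by (yes j≡j′) = cong inj₂ (split-injective f (cong₂ _,_ j≡j′ (Gadget.vertex-injective (clauseOf i) (slot i) (slot i′)
        (trans eq (cong (λ j → Gadget.vertex j (slot i′)) (sym j≡j′))))))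

    NewEdge : Fin (length (red1 f)) → Fin n → Set
    NewEdge i v = OccursIn v (List.lookup (red1 f) i)

    new-edge-arm : ∀ i v → NewEdge i v → Σ[ a ∈ Fin 3 ] Adjacent (slot i) a × v ≡ armVar (clauseOf i) a
    new-edge-arm i v occ = occurs-red1Clause (clauseAt f (clauseOf i)) (slot i) v (subst (OccursIn v) (lookup-red1 f i) occ)

    off-old-edge : ∀ i a w → old w ≢ inj₂ (clauseOf i) → old w ≢ inj₁ (armVar (clauseOf i) a) →
      ¬ OnSeg (place′ (inj₂ i)) (armAt (clauseOf i) a) (place′ w)
    off-old-edge i a w ≢centre ≢arm on =
      disjoint-stays-disjoint (inj₂ i) (inj₁ (armVar j a)) w w no-meet on (onSeg-start (place′ w) (place′ w))
      where
      j = clauseOf i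
      no-meet : ¬ Meet (centre j) (armAt j a) (place (old w)) (place (old w))
      no-meet (t , t∈edge , t∈w) = [ ≢centre , ≢arm ]′ (on-edge (inj₂ j) (inj₁ (armVar j a)) (old w) (old-edge j a)
        (subst (OnSeg (centre j) (armAt j a)) (onSeg-degenerate t∈w) t∈edge))

    on-gadget-edge : ∀ i a → Adjacent (slot i) a → ∀ w → OnSeg (place′ (inj₂ i)) (armAt (clauseOf i) a) (place′ w) →
      w ≡ inj₂ i ⊎ w ≡ inj₁ (armVar (clauseOf i) a)
    on-gadget-edge i a adj (inj₁ u) on = by (u ≟ᶠ armVar (clauseOf i) a)
      where
      by : Dec (u ≡ armVar (clauseOf i) a) → inj₁ u ≡ inj₂ i ⊎ inj₁ u ≡ inj₁ (armVar (clauseOf i) a)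
      by (yes u≡x) = inj₂ (cong inj₁ u≡x)
      by (no  u≢x) = ⊥-elim (off-old-edge i a (inj₁ u) inj₁≢inj₂ (u≢x ∘ inj₁-injective) on)
    on-gadget-edge i a adj (inj₂ i′) on = by (clauseOf i′ ≟ᶠ clauseOf i)
      where
      by : Dec (clauseOf i′ ≡ clauseOf i) → inj₂ i′ ≡ inj₂ i ⊎ inj₂ i′ ≡ inj₁ (armVar (clauseOf i) a)
      by (no  j′≢j) = ⊥-elim (off-old-edge i a (inj₂ i′) (j′≢j ∘ inj₂-injective) (inj₁≢inj₂ ∘ sym) on)
      by (yes j′≡j) = inj₁ (cong inj₂ (split-injective f (cong₂ _,_ j′≡j
        (Gadget.vertex-on-edge (clauseOf i) (slot i) a (slot i′) adj
          (subst (λ j → OnSeg (place′ (inj₂ i)) (armAt (clauseOf i) a) (Gadget.vertex j (slot i′))) j′≡j on)))))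

    old-edges-disjoint : ∀ j₁ a₁ j₂ a₂ → j₁ ≢ j₂ → armVar j₁ a₁ ≢ armVar j₂ a₂ →
      ¬ Meet (centre j₁) (armAt j₁ a₁) (centre j₂) (armAt j₂ a₂)
    old-edges-disjoint j₁ a₁ j₂ a₂ j≢ x≢ (t , t∈₁ , t∈₂) =
      excluded (edges-meet (inj₂ j₁) (inj₁ x₁) (inj₂ j₂) (inj₁ x₂) t (old-edge j₁ a₁) (old-edge j₂ a₂) t∈₁ t∈₂)
      where
      x₁ = armVar j₁ a₁
      x₂ = armVar j₂ a₂
      excluded : ((inj₂ j₁ ≡ inj₂ j₂ × inj₁ x₁ ≡ inj₁ x₂) ⊎ (inj₂ j₁ ≡ inj₁ x₂ × inj₁ x₁ ≡ inj₂ j₂)) ⊎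
                 Σ V (λ v → (v ≡ inj₂ j₁ ⊎ v ≡ inj₁ x₁) × (v ≡ inj₂ j₂ ⊎ v ≡ inj₁ x₂) × (t ≡ place v)) → ⊥
      excluded (inj₁ (inj₁ (j≡ , _)))               = j≢ (inj₂-injective j≡)
      excluded (inj₁ (inj₂ (() , _)))
      excluded (inj₂ (_ , inj₁ refl , inj₁ j≡ , _)) = j≢ (inj₂-injective j≡)
      excluded (inj₂ (_ , inj₁ refl , inj₂ () , _))
      excluded (inj₂ (_ , inj₂ refl , inj₁ () , _))
      excluded (inj₂ (_ , inj₂ refl , inj₂ x≡ , _)) = x≢ (inj₁-injective x≡)

    centres-nondegenerate : ∀ x j₁ j₂ → j₁ ≢ j₂ → BipE (toCNF f) (inj₁ x) (inj₂ j₁) → BipE (toCNF f) (inj₁ x) (inj₂ j₂) →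
      ¬ Degenerate (place (inj₁ x)) (centre j₁) (centre j₂)
    centres-nondegenerate x j₁ j₂ j≢ _  _  (inj₁ X≡C) = inj₁≢inj₂ (place-injective _ _ X≡C)
    centres-nondegenerate x j₁ j₂ j≢ _  _  (inj₂ (inj₁ X≡C)) = inj₁≢inj₂ (place-injective _ _ X≡C)
    centres-nondegenerate x j₁ j₂ j≢ _  e₂ (inj₂ (inj₂ (inj₁ C₁∈XC₂))) =
      [ (λ ()) , j≢ ∘ inj₂-injective ]′ (on-edge (inj₁ x) (inj₂ j₂) (inj₂ j₁) e₂ C₁∈XC₂)
    centres-nondegenerate x j₁ j₂ j≢ e₁ _  (inj₂ (inj₂ (inj₂ C₂∈XC₁))) =
      [ (λ ()) , j≢ ∘ sym ∘ inj₂-injective ]′ (on-edge (inj₁ x) (inj₂ j₁) (inj₂ j₂) e₁ C₂∈XC₁)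

    MeetAt : Fin (length (red1 f)) → Fin n → Fin (length (red1 f)) → Fin n → Point → Set
    MeetAt i₁ v₁ i₂ v₂ t = (i₁ ≡ i₂ × v₁ ≡ v₂) ⊎
      Σ[ w ∈ V′ ] (w ≡ inj₂ i₁ ⊎ w ≡ inj₁ v₁) × (w ≡ inj₂ i₂ ⊎ w ≡ inj₁ v₂) × t ≡ place′ w

    same-gadget-edges-meet : ∀ i₁ a₁ i₂ a₂ → clauseOf i₁ ≡ clauseOf i₂ → Adjacent (slot i₁) a₁ → Adjacent (slot i₂) a₂ →
      ∀ {t} → OnSeg (place′ (inj₂ i₁)) (armAt (clauseOf i₁) a₁) t → OnSeg (place′ (inj₂ i₂)) (armAt (clauseOf i₂) a₂) t →
      MeetAt i₁ (armVar (clauseOf i₁) a₁) i₂ (armVar (clauseOf i₂) a₂) t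
    same-gadget-edges-meet i₁ a₁ i₂ a₂ j≡ adj₁ adj₂ {t} t∈₁ t∈₂ =
      convert (Gadget.edges-meet j₁ (slot i₁) a₁ (slot i₂) a₂ adj₁ adj₂ t∈₁
                 (subst (λ j → OnSeg (Gadget.vertex j (slot i₂)) (armAt j a₂) t) (sym j≡) t∈₂))
      where
      j₁ = clauseOf i₁
      convert : Gadget.EdgesMeet j₁ (slot i₁) a₁ (slot i₂) a₂ t → MeetAt i₁ (armVar j₁ a₁) i₂ (armVar (clauseOf i₂) a₂) t
      convert (inj₁ (k≡ , a≡))        = inj₁ (split-injective f (cong₂ _,_ j≡ k≡) , cong₂ armVar j≡ a≡)
      convert (inj₂ (inj₁ (k≡ , t≡))) =
        inj₂ (inj₂ i₁ , inj₁ refl , inj₁ (cong inj₂ (split-injective f (cong₂ _,_ j≡ k≡))) , t≡)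
      convert (inj₂ (inj₂ (a≡ , t≡))) =
        inj₂ (inj₁ (armVar j₁ a₁) , inj₂ refl , inj₂ (cong inj₁ (cong₂ armVar j≡ a≡)) , t≡)

    different-gadget-edges-meet : ∀ i₁ a₁ i₂ a₂ → clauseOf i₁ ≢ clauseOf i₂ →
      ∀ {t} → OnSeg (place′ (inj₂ i₁)) (armAt (clauseOf i₁) a₁) t → OnSeg (place′ (inj₂ i₂)) (armAt (clauseOf i₂) a₂) t →
      MeetAt i₁ (armVar (clauseOf i₁) a₁) i₂ (armVar (clauseOf i₂) a₂) t
    different-gadget-edges-meet i₁ a₁ i₂ a₂ j≢ {t} t∈₁ t∈₂ = by (x₁ ≟ᶠ x₂)
      where
      j₁ = clauseOf i₁
      j₂ = clauseOf i₂
      x₁ = armVar j₁ a₁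
      x₂ = armVar j₂ a₂
      by : Dec (x₁ ≡ x₂) → MeetAt i₁ x₁ i₂ x₂ t
      by (no x≢) = ⊥-elim (disjoint-stays-disjoint (inj₂ i₁) (inj₁ x₁) (inj₂ i₂) (inj₁ x₂)
                             (old-edges-disjoint j₁ a₁ j₂ a₂ j≢ x≢) t∈₁ t∈₂)
      by (yes x≡) = inj₂ (inj₁ x₁ , inj₂ refl , inj₂ (cong inj₁ x≡) ,
        separatedAt-stays x₁ (inj₂ i₁) (inj₂ i₂)
          (centres-nondegenerate x₁ j₁ j₂ j≢ (old-edge j₁ a₁)
            (subst (λ x → OccursIn x (List.lookup (toCNF f) j₂)) (sym x≡) (old-edge j₂ a₂)))
          (onSeg-sym {place′ (inj₂ i₁)} {place (inj₁ x₁)} t∈₁)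
          (onSeg-sym {place′ (inj₂ i₂)} {place (inj₁ x₁)}
            (subst (λ x → OnSeg (place′ (inj₂ i₂)) (place (inj₁ x)) t) (sym x≡) t∈₂)))

    gadget-edges-meet : ∀ i₁ a₁ i₂ a₂ → Adjacent (slot i₁) a₁ → Adjacent (slot i₂) a₂ → ∀ {t} →
      OnSeg (place′ (inj₂ i₁)) (armAt (clauseOf i₁) a₁) t → OnSeg (place′ (inj₂ i₂)) (armAt (clauseOf i₂) a₂) t →
      MeetAt i₁ (armVar (clauseOf i₁) a₁) i₂ (armVar (clauseOf i₂) a₂) t
    gadget-edges-meet i₁ a₁ i₂ a₂ adj₁ adj₂ {t} t∈₁ t∈₂ = by (clauseOf i₁ ≟ᶠ clauseOf i₂)
      where
      by : Dec (clauseOf i₁ ≡ clauseOf i₂) → MeetAt i₁ (armVar (clauseOf i₁) a₁) i₂ (armVar (clauseOf i₂) a₂) t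
      by (yes j≡) = same-gadget-edges-meet i₁ a₁ i₂ a₂ j≡ adj₁ adj₂ t∈₁ t∈₂
      by (no  j≢) = different-gadget-edges-meet i₁ a₁ i₂ a₂ j≢ t∈₁ t∈₂

    Ends : V′ → V′ → Fin (length (red1 f)) → Fin n → Set
    Ends a b i v = (a ≡ inj₂ i × b ≡ inj₁ v) ⊎ (a ≡ inj₁ v × b ≡ inj₂ i)

    oriented : ∀ a b → BipE (red1 f) a b →
      Σ[ i ∈ Fin (length (red1 f)) ] Σ[ a′ ∈ Fin 3 ] Adjacent (slot i) a′ × Ends a b i (armVar (clauseOf i) a′)
    oriented (inj₂ i) (inj₁ v) occ with new-edge-arm i v occ
    ... | a′ , adj , refl = i , a′ , adj , inj₁ (refl , refl)
    oriented (inj₁ v) (inj₂ i) occ with new-edge-arm i v occ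
    ... | a′ , adj , refl = i , a′ , adj , inj₂ (refl , refl)

    toward-arm : ∀ {a b i v t} → Ends a b i v → OnSeg (place′ a) (place′ b) t → OnSeg (place′ (inj₂ i)) (place′ (inj₁ v)) t
    toward-arm         (inj₁ (refl , refl)) t∈ = t∈
    toward-arm {i = i} {v} (inj₂ (refl , refl)) t∈ = onSeg-sym {place′ (inj₁ v)} {place′ (inj₂ i)} t∈

    Crossing : V′ → V′ → V′ → V′ → Point → Set
    Crossing a b c d t = ((a ≡ c × b ≡ d) ⊎ (a ≡ d × b ≡ c)) ⊎
      Σ V′ λ w → (w ≡ a ⊎ w ≡ b) × (w ≡ c ⊎ w ≡ d) × (t ≡ place′ w)

    MeetAt⇒Crossing : ∀ {a b c d i₁ v₁ i₂ v₂ t} → Ends a b i₁ v₁ → Ends c d i₂ v₂ → MeetAt i₁ v₁ i₂ v₂ t → Crossing a b c d t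
    MeetAt⇒Crossing (inj₁ (refl , refl)) (inj₁ (refl , refl)) (inj₁ (i≡ , v≡)) = inj₁ (inj₁ (cong inj₂ i≡ , cong inj₁ v≡))
    MeetAt⇒Crossing (inj₁ (refl , refl)) (inj₂ (refl , refl)) (inj₁ (i≡ , v≡)) = inj₁ (inj₂ (cong inj₂ i≡ , cong inj₁ v≡))
    MeetAt⇒Crossing (inj₂ (refl , refl)) (inj₁ (refl , refl)) (inj₁ (i≡ , v≡)) = inj₁ (inj₂ (cong inj₁ v≡ , cong inj₂ i≡))
    MeetAt⇒Crossing (inj₂ (refl , refl)) (inj₂ (refl , refl)) (inj₁ (i≡ , v≡)) = inj₁ (inj₁ (cong inj₁ v≡ , cong inj₂ i≡))
    MeetAt⇒Crossing (inj₁ (refl , refl)) (inj₁ (refl , refl)) (inj₂ (w , p , q , r)) = inj₂ (w , p , q , r)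
    MeetAt⇒Crossing (inj₁ (refl , refl)) (inj₂ (refl , refl)) (inj₂ (w , p , q , r)) = inj₂ (w , p , swap q , r)
    MeetAt⇒Crossing (inj₂ (refl , refl)) (inj₁ (refl , refl)) (inj₂ (w , p , q , r)) = inj₂ (w , swap p , q , r)
    MeetAt⇒Crossing (inj₂ (refl , refl)) (inj₂ (refl , refl)) (inj₂ (w , p , q , r)) = inj₂ (w , swap p , swap q , r)

    endpoints : ∀ a b w → BipE (red1 f) a b → OnSeg (place′ a) (place′ b) (place′ w) → w ≡ a ⊎ w ≡ b
    endpoints a b w e on with oriented a b e
    ... | i , a′ , adj , ends@(inj₁ (refl , refl)) = on-gadget-edge i a′ adj w (toward-arm ends on)
    ... | i , a′ , adj , ends@(inj₂ (refl , refl)) = swap (on-gadget-edge i a′ adj w (toward-arm ends on))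

    crossings : ∀ a b c d t → BipE (red1 f) a b → BipE (red1 f) c d →
      OnSeg (place′ a) (place′ b) t → OnSeg (place′ c) (place′ d) t → Crossing a b c d t
    crossings a b c d t e₁ e₂ t∈₁ t∈₂ with oriented a b e₁ | oriented c d e₂
    ... | i₁ , a₁ , adj₁ , ends₁ | i₂ , a₂ , adj₂ , ends₂ =
      MeetAt⇒Crossing ends₁ ends₂ (gadget-edges-meet i₁ a₁ i₂ a₂ adj₁ adj₂ (toward-arm ends₁ t∈₁) (toward-arm ends₂ t∈₂))

    planar : PlanarCNF (red1 f)
    planar = place′ , place′-injective , endpoints , crossings

  red1-planar : ∀ {n} (f : MonoFormula n) → All Distinct3 f → PlanarCNF (toCNF f) → PlanarCNF (red1 f)
  red1-planar f distinct (place , place-injective , on-edge , edges-meet) =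
    Construction.planar f distinct place place-injective on-edge edges-meet

open import Defs
open import Data.Nat using (ℕ; _≤_)
open import Data.Vec using (Vec)
open import Data.Fin using (Fin)
open import Data.Product using (_×_; _,_)
open import Data.List.Relation.Unary.All using (All)
open import Function.Bundles using (_⇔_)
open import Relation.Binary.PropositionalEquality using (_≡_)
open Clauses
open Planarity using (red1-planar)

lemma4p1 : (n : ℕ) (f : MonoFormula n) → All Distinct3 f →
    -- (1) satisfying assignments of f' = exactly-one satisfying assignments of f
    ((a : Assignment n) → Sat a (red1 f) ⇔ ExSat a f) ×
    -- (2) in every satisfying assignment of f', exactly three of the four clauses of each c_j' have exactly one true literal
    ((a : Assignment n) → Sat a (red1 f) → All (λ c → exactlyOneClauses a (red1Clause c) ≡ 3) f) ×
    -- (3) every variable of f' occurs at least twice negated and at least once unnegated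
    ((v : Fin n) → VarOf v (red1 f) → (2 ≤ negOcc v (red1 f)) × (1 ≤ posOcc v (red1 f))) ×
    -- (4) planarity preserving
    (PlanarCNF (toCNF f) → PlanarCNF (red1 f)) ×
    -- (5) parsimonious
    (numExSat f ≡ numSat (red1 f))
lemma4p1 n f distinct =
  (λ a → sat-red1⇔exSat a f) ,
  (λ a → sat-red1⇒exactlyOneClauses a f) ,
  (λ v → occurrence-bounds v f) ,
  red1-planar f distinct ,
  numExSat≡numSat-red1 f
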